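{- Let $r\ge 2$ and $n\ge 0$. With $U_{n,\ell}^{(r)}$ the total number of $\mathbf{u}$-steps at level $\ell+1$ over all paths in $\mathcal{A}_{n+1,0}^{(r)}$ and $S_n^{(r)}=|\mathcal{A}_{n,0}^{(r)}|$, $$\sum_{\ell=0}^{n}(-1)^{\ell}U_{n,\ell}^{(r)}\left(S_{\ell+1}^{(r)}-S_{\ell}^{(r)}\right)=\sum_{\ell=0}^{n}(-1)^{n-\ell}\left(\frac{\delta_{\ell,0}}{r-1}+S_{\ell}^{(r)}\right)\left(S_{n-\ell}(-1,(r-1)^2)+S_{n-\ell+1}(-1,(r-1)^2)\right).$$ In particular, for $r=2$, $\sum_{\ell=0}^{n}(-1)^{\ell}U_{n,\ell}^{(2)}(S_{\ell+1}-S_{\ell})=\delta_{n,0}+S_n$, where $S_n$ is the $n$th large Schröder number.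
   Context: A Dyck path of length $2n$ is a lattice path from $(0,0)$ to $(2n,0)$ weakly above the $x$-axis with steps $\mathbf{u}=(1,1)$, $\mathbf{d}=(1,-1)$; an $r$-colored Dyck path has each $\mathbf{d}$-step colored with one of $r$ colors. $\mathcal{A}_{n,0}^{(r)}$ is the set of $r$-colored Dyck paths of length $2n$ with no two consecutive $\mathbf{d}$-steps of the same color. A step is at level $\ell$ if the ordinate of its endpoint is $\ell$. For parameters $a,b$, $S_n(a,b)=\sum_{k=0}^{n}\binom{n+k}{2k}C_k a^{n-k}b^k$ with $C_k=\frac{1}{k+1}\binom{2k}{k}$; $S_n=S_n(1,1)$ and $S_n^{(r)}=S_n(1,r-1)$. $\delta_{i,0}=1$ if $i=0$ and $0$ otherwise. -}

module Defs where

open import Data.Bool using (Bool; true; false; _∧_; not)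
open import Data.Nat as ℕ using (ℕ; zero; suc; _≡ᵇ_)
open import Data.Nat.Combinatorics using (_C_)
open import Data.Fin using (Fin; _≟_)
open import Data.List using (List; []; _∷_; map; concatMap; filterᵇ; length; allFin)
open import Data.Nat.ListAction using (sum)
open import Data.Integer as ℤ using (ℤ; +_)
open import Data.Rational as ℚ using (ℚ; 0ℚ; 1ℚ; _+_; _*_; -_; _/_)
open import Relation.Nullary.Decidable using (⌊_⌋)

data Step (r : ℕ) : Set where
  u : Step r
  d : Fin r → Step r

words : (r : ℕ) → ℕ → List (List (Step r))
words r zero = [] ∷ []
words r (suc m) = concatMap (λ w → map (λ s → s ∷ w) (u ∷ map d (allFin r))) (words r m)

dyckFrom : {r : ℕ} → ℕ → List (Step r) → Bool
dyckFrom zero [] = true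
dyckFrom (suc h) [] = false
dyckFrom h (u ∷ w) = dyckFrom (suc h) w
dyckFrom zero (d c ∷ w) = false
dyckFrom (suc h) (d c ∷ w) = dyckFrom h w

isDyck : {r : ℕ} → List (Step r) → Bool
isDyck = dyckFrom 0

noSameConsecD : {r : ℕ} → List (Step r) → Bool
noSameConsecD [] = true
noSameConsecD (u ∷ w) = noSameConsecD w
noSameConsecD (d c ∷ []) = true
noSameConsecD (d c ∷ u ∷ w) = noSameConsecD (u ∷ w)
noSameConsecD (d c ∷ d c' ∷ w) = not ⌊ c ≟ c' ⌋ ∧ noSameConsecD (d c' ∷ w)

-- 𝒜_{n,0}^{(r)} : r-coloured Dyck paths of length 2n with no two consecutive
-- d-steps of the same colour (listed without repetition).
A : (r n : ℕ) → List (List (Step r))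
A r n = filterᵇ (λ w → isDyck w ∧ noSameConsecD w) (words r (2 ℕ.* n))

uAtFrom : {r : ℕ} → ℕ → ℕ → List (Step r) → ℕ
uAtFrom ℓ h [] = 0
uAtFrom ℓ h (u ∷ w) = (if' (suc h ≡ᵇ ℓ)) ℕ.+ uAtFrom ℓ (suc h) w
  where
  if' : Bool → ℕ
  if' true = 1
  if' false = 0
uAtFrom ℓ h (d c ∷ w) = uAtFrom ℓ (h ℕ.∸ 1) w

uAt : {r : ℕ} → ℕ → List (Step r) → ℕ
uAt ℓ = uAtFrom ℓ 0

U : (r n ℓ : ℕ) → ℕ
U r n ℓ = sum (map (uAt (suc ℓ)) (A r (suc n)))

-- Catalan number C_k = binom(2k,k)/(k+1) (exact division).
catalan : ℕ → ℕ
catalan k = ((2 ℕ.* k) C k) ℕ./ suc k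

sumℤ : ℕ → (ℕ → ℤ) → ℤ
sumℤ zero f = f 0
sumℤ (suc n) f = sumℤ n f ℤ.+ f (suc n)

sumℚ : ℕ → (ℕ → ℚ) → ℚ
sumℚ zero f = f 0
sumℚ (suc n) f = sumℚ n f + f (suc n)

S : ℕ → ℤ → ℤ → ℤ
S n a b = sumℤ n (λ k → (+ (((n ℕ.+ k) C (2 ℕ.* k)) ℕ.* catalan k)) ℤ.* (a ℤ.^ (n ℕ.∸ k)) ℤ.* (b ℤ.^ k))

Schr : ℕ → ℤ
Schr n = S n (+ 1) (+ 1)

Sr : ℕ → ℕ → ℤ
Sr r n = S n (+ 1) (+ (r ℕ.∸ 1))

sgn : ℕ → ℚ
sgn zero = 1ℚ
sgn (suc k) = - sgn k

δ0 : ℕ → ℚ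
δ0 zero = 1ℚ
δ0 (suc _) = 0ℚ

-- δ_{ℓ,0}/(r-1); only used for r ≥ 2 (the value for r < 2 is an irrelevant 0).
δOverRm1 : ℕ → ℕ → ℚ
δOverRm1 (suc (suc k)) ℓ = δ0 ℓ * ((+ 1) / suc k)
δOverRm1 _ ℓ = 0ℚ

toℚ : ℤ → ℚ
toℚ z = z / 1

{-# OPTIONS --safe #-}
module Submission where

-- Everything is computed with formal power series over ℤ. Write q = r − 1 and A = Σ S_n^{(r)} xⁿ.
-- Substituting b x/(1 − a x)² into the Catalan series C = 1 + x C² shows that Σ S_n(a,b) xⁿ solves
-- G = 1 + a x G + b x G²; in particular A = 1 + x A + q x A².
--
-- Cutting a path at an up-step to level ℓ + 1 and solving the transfer recurrences for admissible
-- prefixes and suffixes gives U_{n,ℓ} = [x^{2n}] Â²(1 + qÂ)(q x² Â²)^ℓ, where Â(x) = A(x²). Since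
-- A_{ℓ+1} − A_ℓ = [x^ℓ] q A², the left-hand side is [x^{2n}] Â²(1 + qÂ) · (q A²) ∘ (−q x² Â²).
-- Both Â · (A ∘ (−q x² Â²)) and Ŵ(x) = W(x²), with W = Σ S_n(1,−q²) xⁿ, solve the same contracting
-- equation, so the left-hand side is [xⁿ] q (1 + qA) W².  On the right, S_m(−1,q²) = (−1)^m W_m and
-- W_{j+1} − W_j = −q² [x^j] W² turn every bracket into q² [x^{n−ℓ}] W², giving the same coefficient.
-- For r = 2, W = 1.

open import Data.Nat using (ℕ)
open import Data.Integer using (ℤ; 0ℤ)
open import Relation.Binary.PropositionalEquality using (_≡_)

module IntegerSums where

  open import Data.Nat as ℕ using (ℕ; zero; suc; _≤_; z≤n)
  open import Data.Nat.Properties using (≤-refl; m≤n⇒m≤1+n)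
  open import Data.Integer using (ℤ; 0ℤ; _+_; _*_)
  open import Data.Integer.Properties hiding (≤-refl)
  open import Algebra.Properties.CommutativeSemigroup +-commutativeSemigroup using (interchange)
  open import Relation.Binary.PropositionalEquality
  open import Defs using (sumℤ)

  sumℤ-cong : ∀ n {f g : ℕ → ℤ} → (∀ k → k ≤ n → f k ≡ g k) → sumℤ n f ≡ sumℤ n g
  sumℤ-cong zero    f≡g = f≡g 0 z≤n
  sumℤ-cong (suc n) f≡g = cong₂ _+_ (sumℤ-cong n (λ k k≤n → f≡g k (m≤n⇒m≤1+n k≤n))) (f≡g (suc n) ≤-refl)

  sumℤ-distrib-+ : ∀ n (f g : ℕ → ℤ) → sumℤ n (λ k → f k + g k) ≡ sumℤ n f + sumℤ n g
  sumℤ-distrib-+ zero    f g = refl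
  sumℤ-distrib-+ (suc n) f g =
    trans (cong (_+ (f (suc n) + g (suc n))) (sumℤ-distrib-+ n f g)) (interchange (sumℤ n f) (sumℤ n g) (f (suc n)) (g (suc n)))

  *-distribˡ-sumℤ : ∀ n a (f : ℕ → ℤ) → sumℤ n (λ k → a * f k) ≡ a * sumℤ n f
  *-distribˡ-sumℤ zero    a f = refl
  *-distribˡ-sumℤ (suc n) a f =
    trans (cong (_+ (a * f (suc n))) (*-distribˡ-sumℤ n a f)) (sym (*-distribˡ-+ a _ _))

  sumℤ-head : ∀ n (f : ℕ → ℤ) → sumℤ (suc n) f ≡ f 0 + sumℤ n (λ k → f (suc k))
  sumℤ-head zero    f = refl
  sumℤ-head (suc n) f = trans (cong (_+ f (suc (suc n))) (sumℤ-head n f)) (+-assoc (f 0) _ _)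

  sumℤ-zero : ∀ n (f : ℕ → ℤ) → (∀ k → k ≤ n → f k ≡ 0ℤ) → sumℤ n f ≡ 0ℤ
  sumℤ-zero n f f≡0 = trans (sumℤ-cong n f≡0) (sumℤ-0 n)
    where
    sumℤ-0 : ∀ n → sumℤ n (λ _ → 0ℤ) ≡ 0ℤ
    sumℤ-0 zero    = refl
    sumℤ-0 (suc n) = trans (+-identityʳ _) (sumℤ-0 n)

module PowerSeries where

  open import Algebra.Bundles using (CommutativeRing)
  open import Algebra.Solver.Ring.AlmostCommutativeRing
    using (AlmostCommutativeRing; fromCommutativeRing; _-Raw-AlmostCommutative⟶_; Induced-equivalence)
  import Algebra.Solver.Ring
  import Relation.Binary.Reasoning.Setoid
  open import Data.Integer as ℤ using (ℤ; 0ℤ; 1ℤ; _+_; _*_; -_)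
  open import Data.Integer.Properties hiding (≤-refl; ≤-<-trans)
  open import Algebra.Properties.CommutativeSemigroup +-commutativeSemigroup using (interchange; x∙yz≈y∙xz)
  open import Data.Maybe using (Maybe; just; nothing)
  open import Data.Nat as ℕ using (ℕ; zero; suc; _≤_; _<_; z≤n; s≤s; _∸_)
  open import Data.Nat.Properties as ℕ using (≤-refl; m≤n⇒m≤1+n; ≤-<-trans)
  open import Data.Product using (_,_)
  open import Relation.Binary.PropositionalEquality
  open import Relation.Nullary using (yes; no)
  open import Defs using (sumℤ)
  open IntegerSums

  Series : Set
  Series = ℕ → ℤ

  infixl 6 _⊕_
  infixl 7 _⊛_
  infix 8 ⊖_

  _⊕_ : Series → Series → Series
  (f ⊕ g) n = f n + g n

  ⊖_ : Series → Series
  (⊖ f) n = - f n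

  shift : Series → Series
  shift f n = f (suc n)

  _⊛_ : Series → Series → Series
  (f ⊛ g) zero    = f 0 * g 0
  (f ⊛ g) (suc n) = f 0 * g (suc n) + (shift f ⊛ g) n

  κ : ℤ → Series
  κ c zero    = c
  κ c (suc n) = 0ℤ

  𝟘 𝟙 : Series
  𝟘 n = 0ℤ
  𝟙 = κ 1ℤ

  X : Series
  X zero          = 0ℤ
  X (suc zero)    = 1ℤ
  X (suc (suc n)) = 0ℤ

  scale : ℤ → Series → Series
  scale a f n = a * f n

  ≗-refl : ∀ {f : Series} → f ≗ f
  ≗-refl _ = refl

  ≗-sym : ∀ {f g : Series} → f ≗ g → g ≗ f
  ≗-sym f≗g n = sym (f≗g n)

  ≗-trans : ∀ {f g h : Series} → f ≗ g → g ≗ h → f ≗ h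
  ≗-trans f≗g g≗h n = trans (f≗g n) (g≗h n)

  ⊕-cong : ∀ {f f′ g g′} → f ≗ f′ → g ≗ g′ → f ⊕ g ≗ f′ ⊕ g′
  ⊕-cong f≗ g≗ n = cong₂ _+_ (f≗ n) (g≗ n)

  ⊖-cong : ∀ {f f′} → f ≗ f′ → ⊖ f ≗ ⊖ f′
  ⊖-cong f≗ n = cong -_ (f≗ n)

  ⊛-cong : ∀ {f f′ g g′} → f ≗ f′ → g ≗ g′ → f ⊛ g ≗ f′ ⊛ g′
  ⊛-cong f≗ g≗ zero    = cong₂ _*_ (f≗ 0) (g≗ 0)
  ⊛-cong f≗ g≗ (suc n) = cong₂ _+_ (cong₂ _*_ (f≗ 0) (g≗ (suc n))) (⊛-cong (f≗ ∘ suc) g≗ n)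
    where open import Function using (_∘_)

  ⊛-zeroˡ : ∀ {f} g → f ≗ 𝟘 → f ⊛ g ≗ 𝟘
  ⊛-zeroˡ g f≗0 zero    = trans (cong (_* g 0) (f≗0 0)) refl
  ⊛-zeroˡ g f≗0 (suc n) =
    trans (cong₂ _+_ (cong (_* g (suc n)) (f≗0 0)) (⊛-zeroˡ g (λ k → f≗0 (suc k)) n)) refl

  ⊛-distribˡ-⊕ : ∀ f g h → f ⊛ (g ⊕ h) ≗ f ⊛ g ⊕ f ⊛ h
  ⊛-distribˡ-⊕ f g h zero    = *-distribˡ-+ (f 0) (g 0) (h 0)
  ⊛-distribˡ-⊕ f g h (suc n) = begin
    f 0 * (g (suc n) + h (suc n)) + (shift f ⊛ (g ⊕ h)) n
      ≡⟨ cong₂ _+_ (*-distribˡ-+ (f 0) (g (suc n)) (h (suc n))) (⊛-distribˡ-⊕ (shift f) g h n) ⟩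
    (f 0 * g (suc n) + f 0 * h (suc n)) + ((shift f ⊛ g) n + (shift f ⊛ h) n)
      ≡⟨ interchange (f 0 * g (suc n)) (f 0 * h (suc n)) _ _ ⟩
    (f ⊛ g ⊕ f ⊛ h) (suc n) ∎
    where open ≡-Reasoning

  ⊛-distribʳ-⊕ : ∀ h f g → (f ⊕ g) ⊛ h ≗ f ⊛ h ⊕ g ⊛ h
  ⊛-distribʳ-⊕ h f g zero    = *-distribʳ-+ (h 0) (f 0) (g 0)
  ⊛-distribʳ-⊕ h f g (suc n) = begin
    (f 0 + g 0) * h (suc n) + ((shift f ⊕ shift g) ⊛ h) n
      ≡⟨ cong₂ _+_ (*-distribʳ-+ (h (suc n)) (f 0) (g 0)) (⊛-distribʳ-⊕ h (shift f) (shift g) n) ⟩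
    (f 0 * h (suc n) + g 0 * h (suc n)) + ((shift f ⊛ h) n + (shift g ⊛ h) n)
      ≡⟨ interchange (f 0 * h (suc n)) (g 0 * h (suc n)) _ _ ⟩
    (f ⊛ h ⊕ g ⊛ h) (suc n) ∎
    where open ≡-Reasoning

  scale-⊛ : ∀ a f g → scale a f ⊛ g ≗ scale a (f ⊛ g)
  scale-⊛ a f g zero    = *-assoc a (f 0) (g 0)
  scale-⊛ a f g (suc n) =
    trans (cong₂ _+_ (*-assoc a (f 0) (g (suc n))) (scale-⊛ a (shift f) g n)) (sym (*-distribˡ-+ a _ _))

  ⊛-comm : ∀ f g → f ⊛ g ≗ g ⊛ f
  ⊛-comm f g zero             = *-comm (f 0) (g 0)
  ⊛-comm f g (suc zero)       =
    trans (+-comm (f 0 * g 1) (f 1 * g 0)) (cong₂ _+_ (*-comm (f 1) (g 0)) (*-comm (f 0) (g 1)))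
  ⊛-comm f g (suc (suc n)) = begin
    f 0 * g (2 ℕ.+ n) + (shift f ⊛ g) (suc n)
      ≡⟨ cong (f 0 * g (2 ℕ.+ n) +_) (⊛-comm (shift f) g (suc n)) ⟩
    f 0 * g (2 ℕ.+ n) + (g 0 * f (2 ℕ.+ n) + (shift g ⊛ shift f) n)
      ≡⟨ cong (λ z → f 0 * g (2 ℕ.+ n) + (g 0 * f (2 ℕ.+ n) + z)) (⊛-comm (shift g) (shift f) n) ⟩
    f 0 * g (2 ℕ.+ n) + (g 0 * f (2 ℕ.+ n) + (shift f ⊛ shift g) n)
      ≡⟨ x∙yz≈y∙xz (f 0 * g (2 ℕ.+ n)) (g 0 * f (2 ℕ.+ n)) _ ⟩
    g 0 * f (2 ℕ.+ n) + (f ⊛ shift g) (suc n)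
      ≡⟨ cong (g 0 * f (2 ℕ.+ n) +_) (⊛-comm f (shift g) (suc n)) ⟩
    g 0 * f (2 ℕ.+ n) + (shift g ⊛ f) (suc n) ∎
    where open ≡-Reasoning

  -- shift (f ⊛ g) unfolds definitionally to scale (f 0) (shift g) ⊕ shift f ⊛ g.
  ⊛-assoc : ∀ f g h → (f ⊛ g) ⊛ h ≗ f ⊛ (g ⊛ h)
  ⊛-assoc f g h zero    = *-assoc (f 0) (g 0) (h 0)
  ⊛-assoc f g h (suc n) = begin
    f 0 * g 0 * h (suc n) + ((scale (f 0) (shift g) ⊕ shift f ⊛ g) ⊛ h) n
      ≡⟨ cong (f 0 * g 0 * h (suc n) +_) (⊛-distribʳ-⊕ h (scale (f 0) (shift g)) (shift f ⊛ g) n) ⟩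
    f 0 * g 0 * h (suc n) + ((scale (f 0) (shift g) ⊛ h) n + ((shift f ⊛ g) ⊛ h) n)
      ≡⟨ cong (λ z → f 0 * g 0 * h (suc n) + z)
           (cong₂ _+_ (scale-⊛ (f 0) (shift g) h n) (⊛-assoc (shift f) g h n)) ⟩
    f 0 * g 0 * h (suc n) + (f 0 * (shift g ⊛ h) n + (shift f ⊛ (g ⊛ h)) n)
      ≡⟨ regroup (f 0) (g 0) (h (suc n)) _ _ ⟩
    f 0 * (g 0 * h (suc n) + (shift g ⊛ h) n) + (shift f ⊛ (g ⊛ h)) n ∎
    where
    open ≡-Reasoning
    open import Data.Integer.Solver using (module +-*-Solver)
    open +-*-Solver
    regroup : ∀ a b c d e → a * b * c + (a * d + e) ≡ a * (b * c + d) + e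
    regroup = solve 5 (λ a b c d e → a :* b :* c :+ (a :* d :+ e) := a :* (b :* c :+ d) :+ e) refl

  ⊛-identityˡ : ∀ f → 𝟙 ⊛ f ≗ f
  ⊛-identityˡ f zero    = *-identityˡ (f 0)
  ⊛-identityˡ f (suc n) =
    trans (cong₂ _+_ (*-identityˡ (f (suc n))) (⊛-zeroˡ f (λ _ → refl) n)) (+-identityʳ (f (suc n)))

  ⊛-identityʳ : ∀ f → f ⊛ 𝟙 ≗ f
  ⊛-identityʳ f n = trans (⊛-comm f 𝟙 n) (⊛-identityˡ f n)

  seriesRing : CommutativeRing _ _
  seriesRing = record
    { Carrier = Series ; _≈_ = _≗_ ; _+_ = _⊕_ ; _*_ = _⊛_ ; -_ = ⊖_ ; 0# = 𝟘 ; 1# = 𝟙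
    ; isCommutativeRing = record
      { isRing = record
        { +-isAbelianGroup = record
          { isGroup = record
            { isMonoid = record
              { isSemigroup = record
                { isMagma = record
                  { isEquivalence = record { refl = ≗-refl ; sym = ≗-sym ; trans = ≗-trans }
                  ; ∙-cong = ⊕-cong }
                ; assoc = λ f g h n → +-assoc (f n) (g n) (h n) }
              ; identity = (λ f n → +-identityˡ (f n)) , (λ f n → +-identityʳ (f n)) }
            ; inverse = (λ f n → +-inverseˡ (f n)) , (λ f n → +-inverseʳ (f n))
            ; ⁻¹-cong = ⊖-cong }
          ; comm = λ f g n → +-comm (f n) (g n) }
        ; *-cong = ⊛-cong
        ; *-assoc = ⊛-assoc
        ; *-identity = ⊛-identityˡ , ⊛-identityʳ
        ; distrib = ⊛-distribˡ-⊕ , ⊛-distribʳ-⊕ }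
      ; *-comm = ⊛-comm } }

  module ≗-Reasoning = Relation.Binary.Reasoning.Setoid (CommutativeRing.setoid seriesRing)

  κ-+ : ∀ a b → κ (a + b) ≗ κ a ⊕ κ b
  κ-+ a b zero    = refl
  κ-+ a b (suc n) = refl

  κ-* : ∀ a b → κ (a * b) ≗ κ a ⊛ κ b
  κ-* a b zero    = refl
  κ-* a b (suc n) = sym (cong₂ _+_ (*-zeroʳ a) (⊛-zeroˡ (κ b) (λ _ → refl) n))

  κ-neg : ∀ a → κ (- a) ≗ ⊖ κ a
  κ-neg a zero    = refl
  κ-neg a (suc n) = refl

  κ-0 : κ 0ℤ ≗ 𝟘
  κ-0 zero    = refl
  κ-0 (suc n) = refl

  κ-homomorphism : ℤ.+-*-rawRing -Raw-AlmostCommutative⟶ fromCommutativeRing seriesRing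
  κ-homomorphism = record
    { ⟦_⟧ = κ ; +-homo = κ-+ ; *-homo = κ-* ; -‿homo = κ-neg ; 0-homo = κ-0 ; 1-homo = λ _ → refl }

  κ-equal? : ∀ a b → Maybe (Induced-equivalence κ-homomorphism a b)
  κ-equal? a b with a ℤ.≟ b
  ... | yes refl = just (λ _ → refl)
  ... | no _     = nothing

  module SeriesSolver = Algebra.Solver.Ring ℤ.+-*-rawRing (fromCommutativeRing seriesRing) κ-homomorphism κ-equal?

  shift-X : shift X ≗ 𝟙
  shift-X zero    = refl
  shift-X (suc n) = refl

  X⊛-suc : ∀ f n → (X ⊛ f) (suc n) ≡ f n
  X⊛-suc f n = trans (cong₂ _+_ (*-zeroˡ (f (suc n))) (trans (⊛-cong shift-X (λ _ → refl) n) (⊛-identityˡ f n)))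
                     (+-identityˡ (f n))

  ⊛-cong-upTo : ∀ m {f f′ g g′} → (∀ j → j ≤ m → f j ≡ f′ j) → (∀ j → j ≤ m → g j ≡ g′ j) →
                (f ⊛ g) m ≡ (f′ ⊛ g′) m
  ⊛-cong-upTo zero    f≡ g≡ = cong₂ _*_ (f≡ 0 z≤n) (g≡ 0 z≤n)
  ⊛-cong-upTo (suc m) f≡ g≡ = cong₂ _+_ (cong₂ _*_ (f≡ 0 z≤n) (g≡ (suc m) ≤-refl))
    (⊛-cong-upTo m (λ j j≤m → f≡ (suc j) (s≤s j≤m)) (λ j j≤m → g≡ j (m≤n⇒m≤1+n j≤m)))

  ⊛-zeroʳ-upTo : ∀ m f g → (∀ j → j ≤ m → g j ≡ 0ℤ) → (f ⊛ g) m ≡ 0ℤ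
  ⊛-zeroʳ-upTo m f g g≡0 =
    trans (⊛-comm f g m) (trans (⊛-cong-upTo m g≡0 (λ _ _ → refl)) (⊛-zeroˡ f (λ _ → refl) m))

  κ-⊛ : ∀ a g n → (κ a ⊛ g) n ≡ a * g n
  κ-⊛ a g zero    = refl
  κ-⊛ a g (suc n) = trans (cong (a * g (suc n) +_) (⊛-zeroˡ g (λ _ → refl) n)) (+-identityʳ _)

  scale≗κ⊛ : ∀ a g → scale a g ≗ κ a ⊛ g
  scale≗κ⊛ a g n = sym (κ-⊛ a g n)

  ⊛-scale : ∀ a f g → f ⊛ scale a g ≗ scale a (f ⊛ g)
  ⊛-scale a f g n = trans (⊛-comm f (scale a g) n) (trans (scale-⊛ a g f n) (cong (a *_) (⊛-comm g f n)))

  ⊛-as-sumℤ : ∀ f g n → (f ⊛ g) n ≡ sumℤ n (λ i → f i * g (n ∸ i))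
  ⊛-as-sumℤ f g zero    = refl
  ⊛-as-sumℤ f g (suc n) =
    trans (cong (f 0 * g (suc n) +_) (⊛-as-sumℤ (shift f) g n)) (sym (sumℤ-head n (λ i → f i * g (suc n ∸ i))))

  ⊛-sumℤ : ∀ N (c : ℕ → ℤ) (g : ℕ → Series) f →
           f ⊛ (λ j → sumℤ N (λ l → c l * g l j)) ≗ (λ m → sumℤ N (λ l → c l * (f ⊛ g l) m))
  ⊛-sumℤ zero    c g f m = ⊛-scale (c 0) f (g 0) m
  ⊛-sumℤ (suc N) c g f m =
    trans (⊛-distribˡ-⊕ f (λ j → sumℤ N (λ l → c l * g l j)) (scale (c (suc N)) (g (suc N))) m)
          (cong₂ _+_ (⊛-sumℤ N c g f m) (⊛-scale (c (suc N)) f (g (suc N)) m))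

  ⊛-vanishes : ∀ d e {f g} → (∀ i → i < d → f i ≡ 0ℤ) → (∀ i → i < e → g i ≡ 0ℤ) →
               ∀ j → j < d ℕ.+ e → (f ⊛ g) j ≡ 0ℤ
  ⊛-vanishes zero    e {f} {g} _  g≡0 j       j<e = ⊛-zeroʳ-upTo j f g (λ i i≤j → g≡0 i (≤-<-trans i≤j j<e))
  ⊛-vanishes (suc d) e {f} {g} f≡0 g≡0 zero    _   = cong (_* g 0) (f≡0 0 (s≤s z≤n))
  ⊛-vanishes (suc d) e {f} {g} f≡0 g≡0 (suc j) (s≤s j<) =
    cong₂ _+_ (cong (_* g (suc j)) (f≡0 0 (s≤s z≤n))) (⊛-vanishes d e (λ i i<d → f≡0 (suc i) (s≤s i<d)) g≡0 j j<)

  pow : Series → ℕ → Series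
  pow f zero    = 𝟙
  pow f (suc l) = f ⊛ pow f l

  pow-cong : ∀ {f g} → f ≗ g → ∀ l → pow f l ≗ pow g l
  pow-cong f≗g zero    = λ _ → refl
  pow-cong f≗g (suc l) = ⊛-cong f≗g (pow-cong f≗g l)

  pow-⊛ : ∀ f g l → pow (f ⊛ g) l ≗ pow f l ⊛ pow g l
  pow-⊛ f g zero    n = sym (⊛-identityˡ 𝟙 n)
  pow-⊛ f g (suc l) n = trans (⊛-cong (λ _ → refl) (pow-⊛ f g l) n) (swap-middle f g (pow f l) (pow g l) n)
    where
    open SeriesSolver
    swap-middle : ∀ a b c d → (a ⊛ b) ⊛ (c ⊛ d) ≗ (a ⊛ c) ⊛ (b ⊛ d)
    swap-middle = solve 4 (λ a b c d → (a :* b) :* (c :* d) := (a :* c) :* (b :* d)) (λ _ → refl)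

  pow-vanishes : ∀ d f → (∀ i → i < d → f i ≡ 0ℤ) → ∀ l j → j < l ℕ.* d → pow f l j ≡ 0ℤ
  pow-vanishes d f f≡0 (suc l) j j< = ⊛-vanishes d (l ℕ.* d) f≡0 (pow-vanishes d f f≡0 l) j j<

  ≗-from-difference : ∀ {a b} → a ⊕ ⊖ b ≗ 𝟘 → a ≗ b
  ≗-from-difference {a} {b} a-b≗0 n = begin
    a n                  ≡⟨ sym (+-identityʳ (a n)) ⟩
    a n + 0ℤ             ≡⟨ cong (a n +_) (sym (+-inverseˡ (b n))) ⟩
    a n + (- b n + b n)  ≡⟨ sym (+-assoc (a n) (- b n) (b n)) ⟩
    (a n + - b n) + b n  ≡⟨ cong (_+ b n) (a-b≗0 n) ⟩
    0ℤ + b n             ≡⟨ +-identityˡ (b n) ⟩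
    b n                  ∎
    where open ≡-Reasoning

  difference-≗𝟘 : ∀ {a b} → a ≗ b → a ⊕ ⊖ b ≗ 𝟘
  difference-≗𝟘 {a} {b} a≗b n = trans (cong (_+ - b n) (a≗b n)) (+-inverseʳ (b n))

  ≗-by-difference : ∀ {a b d} → a ⊕ ⊖ b ≗ d → d ≗ 𝟘 → a ≗ b
  ≗-by-difference a-b≗d d≗0 = ≗-from-difference (λ n → trans (a-b≗d n) (d≗0 n))

  ⊛-≗𝟘 : ∀ c {d} → d ≗ 𝟘 → c ⊛ d ≗ 𝟘
  ⊛-≗𝟘 c {d} d≗0 n = ⊛-zeroʳ-upTo n c d (λ j _ → d≗0 j)

  X²⊛-suc-suc : ∀ g j → (X ⊛ X ⊛ g) (suc (suc j)) ≡ g j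
  X²⊛-suc-suc g j = trans (⊛-assoc X X g (suc (suc j))) (trans (X⊛-suc (X ⊛ g) (suc j)) (X⊛-suc g j))

  X²⊛-one : ∀ g → (X ⊛ X ⊛ g) 1 ≡ 0ℤ
  X²⊛-one g = trans (⊛-assoc X X g 1) (X⊛-suc (X ⊛ g) 0)

  pow-κ : ∀ b k → pow (κ b) k ≗ κ (b ℤ.^ k)
  pow-κ b zero    = ≗-refl
  pow-κ b (suc k) = ≗-trans (⊛-cong (≗-refl {κ b}) (pow-κ b k)) (≗-sym (κ-* b (b ℤ.^ k)))

  pow-+ : ∀ g i j → pow g (i ℕ.+ j) ≗ pow g i ⊛ pow g j
  pow-+ g zero    j = ≗-sym (⊛-identityˡ (pow g j))
  pow-+ g (suc i) j = ≗-trans (⊛-cong (≗-refl {g}) (pow-+ g i j)) (≗-sym (⊛-assoc g (pow g i) (pow g j)))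

  pow-X⊛ : ∀ k g j → (pow X k ⊛ g) (k ℕ.+ j) ≡ g j
  pow-X⊛ zero    g j = ⊛-identityˡ g j
  pow-X⊛ (suc k) g j = trans (⊛-assoc X (pow X k) g (suc (k ℕ.+ j))) (trans (X⊛-suc (pow X k ⊛ g) (k ℕ.+ j)) (pow-X⊛ k g j))

  head-κ⊕X⊛ : ∀ {G H c} → G ≗ κ c ⊕ X ⊛ H → G 0 ≡ c
  head-κ⊕X⊛ {c = c} G≗ = trans (G≗ 0) (+-identityʳ c)

  tail-κ⊕X⊛ : ∀ {G H c} → G ≗ κ c ⊕ X ⊛ H → ∀ m → G (suc m) ≡ H m
  tail-κ⊕X⊛ {H = H} G≗ m = trans (G≗ (suc m)) (trans (+-identityˡ _) (X⊛-suc H m))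

  Causal : (Series → Series) → Set
  Causal Φ = ∀ j {Y₁ Y₂} → (∀ s → s ≤ j → Y₁ s ≡ Y₂ s) → Φ Y₁ j ≡ Φ Y₂ j

  fixed-point-unique : ∀ Φ c → Causal Φ → ∀ {Y₁ Y₂} → Y₁ ≗ c ⊕ X ⊛ Φ Y₁ → Y₂ ≗ c ⊕ X ⊛ Φ Y₂ → Y₁ ≗ Y₂
  fixed-point-unique Φ c causal {Y₁} {Y₂} Y₁≗ Y₂≗ t = below (suc t) t ℕ.≤-refl
    where
    below : ∀ t s → s < t → Y₁ s ≡ Y₂ s
    below (suc t) zero    _         = trans (Y₁≗ 0) (sym (Y₂≗ 0))
    below (suc t) (suc s) (s≤s s<t) = trans (Y₁≗ (suc s)) (trans (cong (c (suc s) +_)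
      (trans (X⊛-suc (Φ Y₁) s) (trans (causal s (λ j j≤s → below t j (≤-<-trans j≤s s<t))) (sym (X⊛-suc (Φ Y₂) s)))))
      (sym (Y₂≗ (suc s))))

  κ⊛X⊛-suc : ∀ a g n → (κ a ⊛ X ⊛ g) (suc n) ≡ a * g n
  κ⊛X⊛-suc a g n = trans (⊛-assoc (κ a) X g (suc n)) (trans (κ-⊛ a (X ⊛ g) (suc n)) (cong (a *_) (X⊛-suc g n)))

  quadratic-suc : ∀ {G} a b → G ≗ 𝟙 ⊕ κ a ⊛ X ⊛ G ⊕ κ b ⊛ X ⊛ G ⊛ G → ∀ n → G (suc n) ≡ a * G n + b * (G ⊛ G) n
  quadratic-suc {G} a b G≗ n = trans (G≗ (suc n))
    (cong₂ _+_ (trans (+-identityˡ _) (κ⊛X⊛-suc a G n)) (trans (⊛-assoc (κ b ⊛ X) G G (suc n)) (κ⊛X⊛-suc b (G ⊛ G) n)))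

module Substitution (f : PowerSeries.Series) (f-0 : f 0 ≡ 0ℤ) where

  open import Data.Integer using (1ℤ; _+_; _*_)
  open import Data.Integer.Properties hiding (≤-refl)
  open import Data.Nat as ℕ using (ℕ; zero; suc; _≤_; _<_; s≤s; _∸_)
  import Data.Nat.Properties as ℕ
  open import Data.Product using (_×_; _,_)
  open import Relation.Binary.PropositionalEquality
  open import Defs using (sumℤ)
  open IntegerSums
  open PowerSeries

  f-vanishes : ∀ i → i < 1 → f i ≡ 0ℤ
  f-vanishes zero    _        = f-0
  f-vanishes (suc i) (s≤s ())

  composeUpTo : ℕ → Series → Series
  composeUpTo N K m = sumℤ N (λ l → K l * pow f l m)

  -- K ∘ f: as f 0 = 0, the powers f^l with l > m do not reach the m-th coefficient.
  compose : Series → Series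
  compose K m = composeUpTo m K m

  composeUpTo-stable : ∀ N N′ K m → N ≤ N′ → (∀ l → N < l → pow f l m ≡ 0ℤ) →
                       composeUpTo N′ K m ≡ composeUpTo N K m
  composeUpTo-stable N N′ K m N≤N′ high≡0 =
    trans (cong (λ z → composeUpTo z K m) (sym (ℕ.m∸n+n≡m N≤N′))) (extend (N′ ∸ N))
    where
    extend : ∀ k → composeUpTo (k ℕ.+ N) K m ≡ composeUpTo N K m
    extend zero    = refl
    extend (suc k) = trans (cong (composeUpTo (k ℕ.+ N) K m +_)
                                 (trans (cong (K (suc (k ℕ.+ N)) *_) (high≡0 (suc (k ℕ.+ N)) (s≤s (ℕ.m≤n+m N k)))) (*-zeroʳ (K (suc (k ℕ.+ N))))))
                           (trans (+-identityʳ _) (extend k))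

  composeUpTo≡compose : ∀ N K m → m ≤ N → composeUpTo N K m ≡ compose K m
  composeUpTo≡compose N K m m≤N = composeUpTo-stable m N K m m≤N
    (λ l m<l → pow-vanishes 1 f f-vanishes l m (subst (m <_) (sym (ℕ.*-identityʳ l)) m<l))

  compose-cong : ∀ {K K′} → K ≗ K′ → compose K ≗ compose K′
  compose-cong K≗ m = sumℤ-cong m (λ l _ → cong (_* pow f l m) (K≗ l))

  compose-⊕ : ∀ K M → compose (K ⊕ M) ≗ compose K ⊕ compose M
  compose-⊕ K M m = trans (sumℤ-cong m (λ l _ → *-distribʳ-+ (pow f l m) (K l) (M l))) (sumℤ-distrib-+ m _ _)

  compose-scale : ∀ a K → compose (scale a K) ≗ scale a (compose K)
  compose-scale a K m = trans (sumℤ-cong m (λ l _ → *-assoc a (K l) (pow f l m))) (*-distribˡ-sumℤ m a _)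

  compose-unfold : ∀ K → compose K ≗ κ (K 0) ⊕ f ⊛ compose (shift K)
  compose-unfold K m = begin
    compose K m                                                ≡⟨ composeUpTo≡compose (suc m) K m (ℕ.n≤1+n m) ⟨
    composeUpTo (suc m) K m                                    ≡⟨ sumℤ-head m (λ l → K l * pow f l m) ⟩
    K 0 * 𝟙 m + sumℤ m (λ l → K (suc l) * (f ⊛ pow f l) m)     ≡⟨ cong₂ _+_ (κ-scales m) (⊛-sumℤ m (K ∘ suc) (pow f) f m) ⟨
    κ (K 0) m + (f ⊛ composeUpTo m (shift K)) m
      ≡⟨ cong (κ (K 0) m +_) (⊛-cong-upTo m (λ _ _ → refl) (λ j j≤m → composeUpTo≡compose m (shift K) j j≤m)) ⟩
    κ (K 0) m + (f ⊛ compose (shift K)) m                      ∎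
    where
    open ≡-Reasoning
    open import Function using (_∘_)
    κ-scales : ∀ m → κ (K 0) m ≡ K 0 * 𝟙 m
    κ-scales zero    = sym (*-identityʳ (K 0))
    κ-scales (suc m) = sym (*-zeroʳ (K 0))

  vanishing-by-divisibility : ∀ {I : Set} (D : I → Series) (next : I → I) →
                              (∀ i → D i ≗ f ⊛ D (next i)) → ∀ i → D i ≗ 𝟘
  vanishing-by-divisibility D next D≗f⊛D i j = below (suc j) i j ℕ.≤-refl
    where
    below : ∀ k i j → j < k → D i j ≡ 0ℤ
    below (suc k) i j j<1+k = trans (D≗f⊛D i j) (⊛-vanishes 1 k f-vanishes (below k (next i)) j j<1+k)

  compose-κ : ∀ a → compose (κ a) ≗ κ a
  compose-κ a m = trans (compose-unfold (κ a) m) (trans (cong (κ a m +_) (⊛-≗𝟘 f compose-𝟘 m)) (+-identityʳ _))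
    where
    compose-𝟘 : compose (shift (κ a)) ≗ 𝟘
    compose-𝟘 m = sumℤ-zero m _ (λ l _ → *-zeroˡ (pow f l m))

  compose-X : compose X ≗ f
  compose-X m = begin
    compose X m                                     ≡⟨ compose-unfold X m ⟩
    κ 0ℤ m + (f ⊛ compose (shift X)) m
      ≡⟨ cong₂ _+_ (κ-0 m) (⊛-cong (λ _ → refl) (λ n → trans (compose-cong shift-X n) (compose-κ 1ℤ n)) m) ⟩
    0ℤ + (f ⊛ 𝟙) m                                  ≡⟨ +-identityˡ _ ⟩
    (f ⊛ 𝟙) m                                       ≡⟨ ⊛-identityʳ f m ⟩
    f m                                             ∎
    where open ≡-Reasoning

  compose-⊛-unfold : ∀ K M → compose (K ⊛ M) ≗
                     κ (K 0) ⊛ κ (M 0) ⊕ f ⊛ (κ (K 0) ⊛ compose (shift M) ⊕ compose (shift K ⊛ M))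
  compose-⊛-unfold K M = begin
    compose (K ⊛ M)                                                            ≈⟨ compose-unfold (K ⊛ M) ⟩
    κ (K 0 * M 0) ⊕ f ⊛ compose (scale (K 0) (shift M) ⊕ shift K ⊛ M)
      ≈⟨ ⊕-cong (κ-* (K 0) (M 0)) (⊛-cong {f} (λ _ → refl) (compose-⊕ (scale (K 0) (shift M)) (shift K ⊛ M))) ⟩
    κ (K 0) ⊛ κ (M 0) ⊕ f ⊛ (compose (scale (K 0) (shift M)) ⊕ compose (shift K ⊛ M))
      ≈⟨ ⊕-cong {κ (K 0) ⊛ κ (M 0)} (λ _ → refl) (⊛-cong {f} (λ _ → refl) (⊕-cong {compose (scale (K 0) (shift M))}
           (λ n → trans (compose-scale (K 0) (shift M) n) (scale≗κ⊛ (K 0) (compose (shift M)) n)) (λ _ → refl))) ⟩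
    κ (K 0) ⊛ κ (M 0) ⊕ f ⊛ (κ (K 0) ⊛ compose (shift M) ⊕ compose (shift K ⊛ M)) ∎
    where open ≗-Reasoning

  compose-⊛ : ∀ K M → compose (K ⊛ M) ≗ compose K ⊛ compose M
  compose-⊛ K M = ≗-from-difference (vanishing-by-divisibility defect next defect-step (K , M))
    where
    defect : Series × Series → Series
    defect (K , M) = compose (K ⊛ M) ⊕ ⊖ (compose K ⊛ compose M)
    next : Series × Series → Series × Series
    next (K , M) = (shift K , M)
    open SeriesSolver
    product-defect : ∀ a b F P Q R →
      a ⊛ b ⊕ F ⊛ (a ⊛ Q ⊕ R) ⊕ ⊖ ((a ⊕ F ⊛ P) ⊛ (b ⊕ F ⊛ Q)) ≗ F ⊛ (R ⊕ ⊖ (P ⊛ (b ⊕ F ⊛ Q)))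
    product-defect = solve 6 (λ a b F P Q R →
      a :* b :+ F :* (a :* Q :+ R) :- (a :+ F :* P) :* (b :+ F :* Q) := F :* (R :- P :* (b :+ F :* Q))) (λ _ → refl)
    defect-step : ∀ p → defect p ≗ f ⊛ defect (next p)
    defect-step (K , M) = begin
      compose (K ⊛ M) ⊕ ⊖ (compose K ⊛ compose M)
        ≈⟨ ⊕-cong (compose-⊛-unfold K M) (⊖-cong (⊛-cong (compose-unfold K) (compose-unfold M))) ⟩
      κ (K 0) ⊛ κ (M 0) ⊕ f ⊛ (κ (K 0) ⊛ Q ⊕ R) ⊕ ⊖ ((κ (K 0) ⊕ f ⊛ P) ⊛ (κ (M 0) ⊕ f ⊛ Q))
        ≈⟨ product-defect (κ (K 0)) (κ (M 0)) f P Q R ⟩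
      f ⊛ (R ⊕ ⊖ (P ⊛ (κ (M 0) ⊕ f ⊛ Q)))
        ≈⟨ ⊛-cong {f} (λ _ → refl) (⊕-cong {R} (λ _ → refl) (⊖-cong (⊛-cong {P} (λ _ → refl) (λ n → sym (compose-unfold M n))))) ⟩
      f ⊛ (R ⊕ ⊖ (P ⊛ compose M)) ∎
      where
      open ≗-Reasoning
      P Q R : Series
      P = compose (shift K)
      Q = compose (shift M)
      R = compose (shift K ⊛ M)

  compose-quadratic : ∀ a b A → A ≗ 𝟙 ⊕ κ a ⊛ X ⊛ A ⊕ κ b ⊛ X ⊛ A ⊛ A →
                      compose A ≗ 𝟙 ⊕ κ a ⊛ f ⊛ compose A ⊕ κ b ⊛ f ⊛ compose A ⊛ compose A
  compose-quadratic a b A A≗ = begin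
    compose A                                                            ≈⟨ compose-cong A≗ ⟩
    compose (𝟙 ⊕ κ a ⊛ X ⊛ A ⊕ κ b ⊛ X ⊛ A ⊛ A)
      ≈⟨ ≗-trans (compose-⊕ (𝟙 ⊕ κ a ⊛ X ⊛ A) (κ b ⊛ X ⊛ A ⊛ A)) (⊕-cong (compose-⊕ 𝟙 (κ a ⊛ X ⊛ A)) (λ _ → refl)) ⟩
    compose 𝟙 ⊕ compose (κ a ⊛ X ⊛ A) ⊕ compose (κ b ⊛ X ⊛ A ⊛ A)
      ≈⟨ ⊕-cong (⊕-cong (compose-κ 1ℤ) (linear a)) quadratic ⟩
    𝟙 ⊕ κ a ⊛ f ⊛ compose A ⊕ κ b ⊛ f ⊛ compose A ⊛ compose A           ∎
    where
    open ≗-Reasoning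
    linear : ∀ c → compose (κ c ⊛ X ⊛ A) ≗ κ c ⊛ f ⊛ compose A
    linear c = ≗-trans (compose-⊛ (κ c ⊛ X) A)
                 (⊛-cong (≗-trans (compose-⊛ (κ c) X) (⊛-cong (compose-κ c) compose-X)) ≗-refl)
    quadratic : compose (κ b ⊛ X ⊛ A ⊛ A) ≗ κ b ⊛ f ⊛ compose A ⊛ compose A
    quadratic = ≗-trans (compose-⊛ (κ b ⊛ X ⊛ A) A) (⊛-cong (linear b) ≗-refl)

  compose-X²-even : f ≗ X ⊛ X → ∀ K n → compose K (2 ℕ.* n) ≡ K n
  compose-X²-even f≗X² K zero    = *-identityʳ (K 0)
  compose-X²-even f≗X² K (suc n) = begin
    compose K (2 ℕ.* suc n)                         ≡⟨ cong (compose K) (ℕ.*-suc 2 n) ⟩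
    compose K (suc (suc (2 ℕ.* n)))                 ≡⟨ compose-unfold K (suc (suc (2 ℕ.* n))) ⟩
    0ℤ + (f ⊛ compose (shift K)) (suc (suc (2 ℕ.* n)))  ≡⟨ +-identityˡ ((f ⊛ compose (shift K)) (suc (suc (2 ℕ.* n)))) ⟩
    (f ⊛ compose (shift K)) (suc (suc (2 ℕ.* n)))   ≡⟨ ⊛-cong f≗X² (λ _ → refl) (suc (suc (2 ℕ.* n))) ⟩
    (X ⊛ X ⊛ compose (shift K)) (suc (suc (2 ℕ.* n))) ≡⟨ X²⊛-suc-suc (compose (shift K)) (2 ℕ.* n) ⟩
    compose (shift K) (2 ℕ.* n)                     ≡⟨ compose-X²-even f≗X² (shift K) n ⟩
    K (suc n)                                       ∎
    where open ≡-Reasoning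

module CatalanNumbers where

  open import Data.Nat
  open import Data.Nat.Properties
  open import Data.Nat.Combinatorics using (_C_; nCk+nC[k+1]≡[n+1]C[k+1]; k>n⇒nCk≡0; nC1≡n; nCk≡nC[n∸k])
  open import Data.Nat.DivMod using (m*n/n≡m)
  open import Relation.Binary.PropositionalEquality
  open import Data.Nat.Solver using (module +-*-Solver)
  open +-*-Solver
  open import Defs using (catalan)

  pascal : ∀ n k → suc n C suc k ≡ n C k + n C suc k
  pascal n k = sym (nCk+nC[k+1]≡[n+1]C[k+1] n k)

  absorption : ∀ n k → suc k * (suc n C suc k) ≡ suc n * (n C k)
  absorption zero    zero    = refl
  absorption zero    (suc k) rewrite k>n⇒nCk≡0 {1} {suc (suc k)} (s≤s (s≤s z≤n)) | k>n⇒nCk≡0 {0} {suc k} (s≤s z≤n)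
                             = *-zeroʳ (suc (suc k))
  absorption (suc n) zero    rewrite nC1≡n (suc (suc n)) = trans (*-identityˡ (suc (suc n))) (sym (*-identityʳ (suc (suc n))))
  absorption (suc n) (suc j) = begin
    suc (suc j) * (suc (suc n) C suc (suc j))                 ≡⟨ cong (suc (suc j) *_) (pascal (suc n) (suc j)) ⟩
    suc (suc j) * (suc n C suc j + suc n C suc (suc j))       ≡⟨ split-factor j (suc n C suc j) (suc n C suc (suc j)) ⟩
    suc n C suc j + suc j * (suc n C suc j) + suc (suc j) * (suc n C suc (suc j))
      ≡⟨ cong₂ (λ a b → suc n C suc j + a + b) (absorption n j) (absorption n (suc j)) ⟩
    suc n C suc j + suc n * (n C j) + suc n * (n C suc j)     ≡⟨ +-assoc (suc n C suc j) _ _ ⟩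
    suc n C suc j + (suc n * (n C j) + suc n * (n C suc j))   ≡⟨ cong (suc n C suc j +_) (*-distribˡ-+ (suc n) (n C j) (n C suc j)) ⟨
    suc n C suc j + suc n * (n C j + n C suc j)               ≡⟨ cong (λ z → suc n C suc j + suc n * z) (pascal n j) ⟨
    suc (suc n) * (suc n C suc j)                             ∎
    where
    open ≡-Reasoning
    split-factor : ∀ j a b → suc (suc j) * (a + b) ≡ a + suc j * a + suc (suc j) * b
    split-factor = solve 3 (λ j a b → (con 2 :+ j) :* (a :+ b) := a :+ (con 1 :+ j) :* a :+ (con 2 :+ j) :* b) refl

  2k+1≡k+[k+1] : ∀ k → suc (2 * k) ≡ k + suc k
  2k+1≡k+[k+1] = solve 1 (λ k → con 1 :+ con 2 :* k := k :+ (con 1 :+ k)) refl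

  centralBinomial : ℕ → ℕ
  centralBinomial k = (2 * k) C k

  suc-*-[2k]C[k+1] : ∀ k → suc k * ((2 * k) C suc k) ≡ k * centralBinomial k
  suc-*-[2k]C[k+1] k = +-cancelʳ-≡ (suc k * centralBinomial k) _ _ (begin
    suc k * ((2 * k) C suc k) + suc k * centralBinomial k  ≡⟨ *-distribˡ-+ (suc k) _ (centralBinomial k) ⟨
    suc k * ((2 * k) C suc k + centralBinomial k)           ≡⟨ cong (suc k *_) (trans (+-comm ((2 * k) C suc k) _) (sym (pascal (2 * k) k))) ⟩
    suc k * (suc (2 * k) C suc k)                           ≡⟨ absorption (2 * k) k ⟩
    suc (2 * k) * centralBinomial k                         ≡⟨ cong (_* centralBinomial k) (2k+1≡k+[k+1] k) ⟩
    (k + suc k) * centralBinomial k                         ≡⟨ *-distribʳ-+ (centralBinomial k) k (suc k) ⟩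
    k * centralBinomial k + suc k * centralBinomial k       ∎)
    where
    open ≡-Reasoning

  -- C(2k,k) = (k+1)(C(2k,k) − C(2k,k+1)), so the division defining catalan is exact.
  catalan*suc : ∀ k → catalan k * suc k ≡ centralBinomial k
  catalan*suc k = begin
    catalan k * suc k                    ≡⟨ cong (λ z → (z / suc k) * suc k) (sym d*suc) ⟩
    ((d * suc k) / suc k) * suc k        ≡⟨ cong (_* suc k) (m*n/n≡m d (suc k)) ⟩
    d * suc k                            ≡⟨ d*suc ⟩
    centralBinomial k                    ∎
    where
    open ≡-Reasoning
    d : ℕ
    d = centralBinomial k ∸ (2 * k) C suc k
    d*suc : d * suc k ≡ centralBinomial k
    d*suc = begin
      d * suc k                                                         ≡⟨ *-comm d (suc k) ⟩
      suc k * d                                                         ≡⟨ *-distribˡ-∸ (suc k) (centralBinomial k) ((2 * k) C suc k) ⟩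
      suc k * centralBinomial k ∸ suc k * ((2 * k) C suc k)             ≡⟨ cong (suc k * centralBinomial k ∸_) (suc-*-[2k]C[k+1] k) ⟩
      (centralBinomial k + k * centralBinomial k) ∸ k * centralBinomial k ≡⟨ m+n∸n≡m (centralBinomial k) (k * centralBinomial k) ⟩
      centralBinomial k                                                 ∎

  centralBinomial-recurrence : ∀ k → suc k * centralBinomial (suc k) ≡ (4 * k + 2) * centralBinomial k
  centralBinomial-recurrence k = *-cancelˡ-≡ (suc k * centralBinomial (suc k)) ((4 * k + 2) * centralBinomial k) (suc k) (begin
    suc k * (suc k * centralBinomial (suc k))               ≡⟨ cong (λ z → suc k * (suc k * (z C suc k))) (*-suc 2 k) ⟩
    suc k * (suc k * (suc (suc (2 * k)) C suc k))           ≡⟨ cong (suc k *_) (absorption (suc (2 * k)) k) ⟩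
    suc k * (suc (suc (2 * k)) * (suc (2 * k) C k))         ≡⟨ cong (λ z → suc k * (suc (suc (2 * k)) * z)) symmetric ⟩
    suc k * (suc (suc (2 * k)) * (suc (2 * k) C suc k))     ≡⟨ x∙yz≈y∙xz (suc k) (suc (suc (2 * k))) (suc (2 * k) C suc k) ⟩
    suc (suc (2 * k)) * (suc k * (suc (2 * k) C suc k))     ≡⟨ cong (suc (suc (2 * k)) *_) (absorption (2 * k) k) ⟩
    suc (suc (2 * k)) * (suc (2 * k) * centralBinomial k)   ≡⟨ rearrange k (centralBinomial k) ⟩
    suc k * ((4 * k + 2) * centralBinomial k)               ∎)
    where
    open ≡-Reasoning
    open import Algebra.Properties.CommutativeSemigroup *-commutativeSemigroup using (x∙yz≈y∙xz)
    symmetric : suc (2 * k) C k ≡ suc (2 * k) C suc k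
    symmetric = trans (nCk≡nC[n∸k] (≤-trans (m≤n*m k 2) (n≤1+n _)))
                      (cong (suc (2 * k) C_) (trans (cong (_∸ k) (2k+1≡k+[k+1] k)) (m+n∸m≡n k (suc k))))
    rearrange : ∀ k c → suc (suc (2 * k)) * (suc (2 * k) * c) ≡ suc k * ((4 * k + 2) * c)
    rearrange = solve 2 (λ k c → (con 2 :+ con 2 :* k) :* ((con 1 :+ con 2 :* k) :* c) := (con 1 :+ k) :* ((con 4 :* k :+ con 2) :* c)) refl

  catalan-recurrence : ∀ k → suc (suc k) * catalan (suc k) ≡ (4 * k + 2) * catalan k
  catalan-recurrence k = *-cancelˡ-≡ (suc (suc k) * catalan (suc k)) ((4 * k + 2) * catalan k) (suc k) (begin
    suc k * (suc (suc k) * catalan (suc k)) ≡⟨ cong (suc k *_) (trans (*-comm (suc (suc k)) (catalan (suc k))) (catalan*suc (suc k))) ⟩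
    suc k * centralBinomial (suc k)         ≡⟨ centralBinomial-recurrence k ⟩
    (4 * k + 2) * centralBinomial k         ≡⟨ cong ((4 * k + 2) *_) (catalan*suc k) ⟨
    (4 * k + 2) * (catalan k * suc k)       ≡⟨ solve 3 (λ a c s → a :* (c :* s) := s :* (a :* c)) refl (4 * k + 2) (catalan k) (suc k) ⟩
    suc k * ((4 * k + 2) * catalan k)       ∎)
    where open ≡-Reasoning

module CatalanSeries where

  open import Data.Nat as ℕ using (ℕ; zero; suc)
  open import Data.Integer as ℤ using (+_; 0ℤ; 1ℤ; _+_; _*_; -_)
  open import Data.Integer.Properties
  open import Data.Integer.Solver using (module +-*-Solver)
  open import Data.Sum using (inj₂)
  open import Relation.Binary.PropositionalEquality
  open import Defs using (catalan)
  open PowerSeries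
  open CatalanNumbers using (catalan-recurrence)

  θ : Series → Series
  θ K n = + n * K n

  θ-⊕ : ∀ K M → θ (K ⊕ M) ≗ θ K ⊕ θ M
  θ-⊕ K M n = *-distribˡ-+ (+ n) (K n) (M n)

  θ-⊖ : ∀ K → θ (⊖ K) ≗ ⊖ θ K
  θ-⊖ K n = sym (neg-distribʳ-* (+ n) (K n))

  θ-κ : ∀ a → θ (κ a) ≗ 𝟘
  θ-κ a zero    = *-zeroˡ a
  θ-κ a (suc n) = *-zeroʳ (+ suc n)

  θ-X : θ X ≗ X
  θ-X zero          = refl
  θ-X (suc zero)    = refl
  θ-X (suc (suc n)) = *-zeroʳ (+ suc (suc n))

  shift-θ : ∀ K → shift (θ K) ≗ θ (shift K) ⊕ shift K
  shift-θ K j = trans (*-distribʳ-+ (K (suc j)) 1ℤ (+ j))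
                      (trans (cong (_+ (+ j * K (suc j))) (*-identityˡ (K (suc j)))) (+-comm (K (suc j)) _))

  θ-⊛ : ∀ K M → θ (K ⊛ M) ≗ θ K ⊛ M ⊕ K ⊛ θ M
  θ-⊛ K M zero    = sym (trans (cong₂ _+_ (cong (_* M 0) (*-zeroˡ (K 0))) (*-zeroʳ (K 0))) (sym (*-zeroˡ (K 0 * M 0))))
  θ-⊛ K M (suc n) = sym (begin
    (θ K ⊛ M ⊕ K ⊛ θ M) (suc n)
      ≡⟨ cong (λ z → 0ℤ * K 0 * M (suc n) + z + (K 0 * (+ suc n * M (suc n)) + (shift K ⊛ θ M) n))
              (trans (⊛-cong (shift-θ K) (λ _ → refl) n) (⊛-distribʳ-⊕ M (θ (shift K)) (shift K) n)) ⟩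
    0ℤ * K 0 * M (suc n) + ((θ (shift K) ⊛ M) n + (shift K ⊛ M) n) + (K 0 * (+ suc n * M (suc n)) + (shift K ⊛ θ M) n)
      ≡⟨ leibniz-step (+ n) (K 0) (M (suc n)) ((shift K ⊛ M) n) ((θ (shift K) ⊛ M) n) ((shift K ⊛ θ M) n) (θ-⊛ (shift K) M n) ⟩
    θ (K ⊛ M) (suc n) ∎)
    where
    open ≡-Reasoning
    open +-*-Solver
    leibniz-step : ∀ s k m c a b → s * c ≡ a + b →
                   0ℤ * k * m + (a + c) + (k * ((1ℤ + s) * m) + b) ≡ (1ℤ + s) * (k * m + c)
    leibniz-step s k m c a b sc≡a+b = begin
      0ℤ * k * m + (a + c) + (k * ((1ℤ + s) * m) + b)
        ≡⟨ solve 6 (λ s k m c a b → con 0ℤ :* k :* m :+ (a :+ c) :+ (k :* ((con 1ℤ :+ s) :* m) :+ b)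
                                  := (a :+ b) :+ c :+ k :* ((con 1ℤ :+ s) :* m)) refl s k m c a b ⟩
      (a + b) + c + k * ((1ℤ + s) * m)   ≡⟨ cong (λ z → z + c + k * ((1ℤ + s) * m)) sc≡a+b ⟨
      s * c + c + k * ((1ℤ + s) * m)
        ≡⟨ solve 4 (λ s k m c → s :* c :+ c :+ k :* ((con 1ℤ :+ s) :* m) := (con 1ℤ :+ s) :* (k :* m :+ c)) refl s k m c ⟩
      (1ℤ + s) * (k * m + c)             ∎

  catalanSeries : Series
  catalanSeries k = + catalan k

  private
    C : Series
    C = catalanSeries

  catalan-recurrenceℤ : ∀ m → (+ 2 + + m) * C (suc m) ≡ (+ 4 * + m + + 2) * C m
  catalan-recurrenceℤ m = begin
    + (2 ℕ.+ m) * + catalan (suc m)     ≡⟨ pos-* (2 ℕ.+ m) (catalan (suc m)) ⟨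
    + ((2 ℕ.+ m) ℕ.* catalan (suc m))   ≡⟨ cong +_ (catalan-recurrence m) ⟩
    + ((4 ℕ.* m ℕ.+ 2) ℕ.* catalan m)   ≡⟨ pos-* (4 ℕ.* m ℕ.+ 2) (catalan m) ⟩
    + (4 ℕ.* m ℕ.+ 2) * + catalan m     ≡⟨ cong (_* + catalan m) (trans (pos-+ (4 ℕ.* m) 2) (cong (_+ + 2) (pos-* 4 m))) ⟩
    (+ 4 * + m + + 2) * + catalan m     ∎
    where open ≡-Reasoning

  catalan-ode : θ C ⊕ ⊖ (κ (+ 4) ⊛ (X ⊛ θ C)) ≗ 𝟙 ⊕ ⊖ C ⊕ κ (+ 2) ⊛ (X ⊛ C)
  catalan-ode zero    = refl
  catalan-ode (suc m) = begin
    (1ℤ + + m) * C (suc m) + - (κ (+ 4) ⊛ (X ⊛ θ C)) (suc m)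
      ≡⟨ cong (λ z → (1ℤ + + m) * C (suc m) + - z) (trans (κ-⊛ (+ 4) (X ⊛ θ C) (suc m)) (cong (+ 4 *_) (X⊛-suc (θ C) m))) ⟩
    (1ℤ + + m) * C (suc m) + - (+ 4 * (+ m * C m))
      ≡⟨ rearrange (+ m) (C m) (C (suc m)) (catalan-recurrenceℤ m) ⟩
    0ℤ + - C (suc m) + + 2 * C m
      ≡⟨ cong (_+_ (0ℤ + - C (suc m))) (trans (κ-⊛ (+ 2) (X ⊛ C) (suc m)) (cong (+ 2 *_) (X⊛-suc C m))) ⟨
    (𝟙 ⊕ ⊖ C ⊕ κ (+ 2) ⊛ (X ⊛ C)) (suc m) ∎
    where
    open ≡-Reasoning
    open +-*-Solver
    rearrange : ∀ s c c′ → (+ 2 + s) * c′ ≡ (+ 4 * s + + 2) * c → (1ℤ + s) * c′ + - (+ 4 * (s * c)) ≡ 0ℤ + - c′ + + 2 * c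
    rearrange s c c′ rec = begin
      (1ℤ + s) * c′ + - (+ 4 * (s * c))
        ≡⟨ solve 3 (λ s c c′ → (con 1ℤ :+ s) :* c′ :- con (+ 4) :* (s :* c)
                             := (con (+ 2) :+ s) :* c′ :- (con (+ 4) :* s :+ con (+ 2)) :* c :+ (con 0ℤ :- c′ :+ con (+ 2) :* c)) refl s c c′ ⟩
      (+ 2 + s) * c′ + - ((+ 4 * s + + 2) * c) + (0ℤ + - c′ + + 2 * c)
        ≡⟨ cong (λ z → z + - ((+ 4 * s + + 2) * c) + (0ℤ + - c′ + + 2 * c)) rec ⟩
      (+ 4 * s + + 2) * c + - ((+ 4 * s + + 2) * c) + (0ℤ + - c′ + + 2 * c)
        ≡⟨ cong (_+ (0ℤ + - c′ + + 2 * c)) (+-inverseʳ ((+ 4 * s + + 2) * c)) ⟩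
      0ℤ + (0ℤ + - c′ + + 2 * c)
        ≡⟨ +-identityˡ _ ⟩
      0ℤ + - c′ + + 2 * c ∎

  quadratic-defect : Series
  quadratic-defect = X ⊛ C ⊛ C ⊕ ⊖ C ⊕ 𝟙

  private
    Q : Series
    Q = quadratic-defect

  -- Q solves θQ − 4XθQ + Q = 0: it is (2XC − 1) times the defect of the Catalan differential equation.
  quadratic-defect-ode : θ Q ⊕ ⊖ (κ (+ 4) ⊛ (X ⊛ θ Q)) ⊕ Q ≗ 𝟘
  quadratic-defect-ode = begin
    θ Q ⊕ ⊖ (κ (+ 4) ⊛ (X ⊛ θ Q)) ⊕ Q
      ≈⟨ ⊕-cong (⊕-cong θQ (⊖-cong (⊛-cong ≗-refl (⊛-cong ≗-refl θQ)))) ≗-refl ⟩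
    P ⊕ ⊖ (κ (+ 4) ⊛ (X ⊛ P)) ⊕ Q
      ≈⟨ factor X C (θ C) ⟩
    (κ (+ 2) ⊛ X ⊛ C ⊕ ⊖ 𝟙) ⊛ (θ C ⊕ ⊖ (κ (+ 4) ⊛ (X ⊛ θ C)) ⊕ ⊖ (𝟙 ⊕ ⊖ C ⊕ κ (+ 2) ⊛ (X ⊛ C)))
      ≈⟨ ⊛-≗𝟘 (κ (+ 2) ⊛ X ⊛ C ⊕ ⊖ 𝟙) (difference-≗𝟘 catalan-ode) ⟩
    𝟘 ∎
    where
    open ≗-Reasoning
    P : Series
    P = (X ⊛ C ⊕ X ⊛ θ C) ⊛ C ⊕ X ⊛ C ⊛ θ C ⊕ ⊖ θ C ⊕ κ 0ℤ
    θQ : θ Q ≗ P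
    θQ = ≗-trans (θ-⊕ (X ⊛ C ⊛ C ⊕ ⊖ C) 𝟙)
           (⊕-cong (≗-trans (θ-⊕ (X ⊛ C ⊛ C) (⊖ C))
                     (⊕-cong (≗-trans (θ-⊛ (X ⊛ C) C) (⊕-cong (⊛-cong (≗-trans (θ-⊛ X C) (⊕-cong (⊛-cong θ-X ≗-refl) ≗-refl)) ≗-refl) ≗-refl))
                             (θ-⊖ C)))
                   (≗-trans (θ-κ 1ℤ) (≗-sym κ-0)))
    open SeriesSolver
    factor : ∀ x c t →
      ((x ⊛ c ⊕ x ⊛ t) ⊛ c ⊕ x ⊛ c ⊛ t ⊕ ⊖ t ⊕ κ 0ℤ) ⊕ ⊖ (κ (+ 4) ⊛ (x ⊛ ((x ⊛ c ⊕ x ⊛ t) ⊛ c ⊕ x ⊛ c ⊛ t ⊕ ⊖ t ⊕ κ 0ℤ)))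
        ⊕ (x ⊛ c ⊛ c ⊕ ⊖ c ⊕ 𝟙)
      ≗ (κ (+ 2) ⊛ x ⊛ c ⊕ ⊖ 𝟙) ⊛ (t ⊕ ⊖ (κ (+ 4) ⊛ (x ⊛ t)) ⊕ ⊖ (𝟙 ⊕ ⊖ c ⊕ κ (+ 2) ⊛ (x ⊛ c)))
    factor = solve 3 (λ x c t →
      ((x :* c :+ x :* t) :* c :+ x :* c :* t :- t :+ con 0ℤ) :- (con (+ 4) :* (x :* ((x :* c :+ x :* t) :* c :+ x :* c :* t :- t :+ con 0ℤ)))
        :+ (x :* c :* c :- c :+ con 1ℤ)
      := (con (+ 2) :* x :* c :- con 1ℤ) :* (t :- (con (+ 4) :* (x :* t)) :- (con 1ℤ :- c :+ con (+ 2) :* (x :* c)))) (λ _ → refl)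

  -- Coefficientwise the equation reads (m + 2) Q (m + 1) = 4 m Q m, and Q 0 = 0.
  quadratic-defect≗𝟘 : Q ≗ 𝟘
  quadratic-defect≗𝟘 zero    = refl
  quadratic-defect≗𝟘 (suc m) = cancel (Q (suc m)) m (begin
    (+ 2 + + m) * Q (suc m)
      ≡⟨ solve 2 (λ s q → (con (+ 2) :+ s) :* q := (con 1ℤ :+ s) :* q :+ con 0ℤ :+ q) refl (+ m) (Q (suc m)) ⟩
    (1ℤ + + m) * Q (suc m) + 0ℤ + Q (suc m)
      ≡⟨ cong (λ z → (1ℤ + + m) * Q (suc m) + z + Q (suc m)) previous-term≡0 ⟨
    (1ℤ + + m) * Q (suc m) + - (κ (+ 4) ⊛ (X ⊛ θ Q)) (suc m) + Q (suc m)
      ≡⟨ quadratic-defect-ode (suc m) ⟩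
    0ℤ ∎)
    where
    open ≡-Reasoning
    open +-*-Solver
    previous-term≡0 : - (κ (+ 4) ⊛ (X ⊛ θ Q)) (suc m) ≡ 0ℤ
    previous-term≡0 = cong -_ (trans (κ-⊛ (+ 4) (X ⊛ θ Q) (suc m))
      (trans (cong (+ 4 *_) (trans (X⊛-suc (θ Q) m) (trans (cong (+ m *_) (quadratic-defect≗𝟘 m)) (*-zeroʳ (+ m)))))
             (*-zeroʳ (+ 4))))
    cancel : ∀ q (s : ℕ) → (+ 2 + + s) * q ≡ 0ℤ → q ≡ 0ℤ
    cancel q s [2+s]q≡0 with i*j≡0⇒i≡0∨j≡0 (+ 2 + + s) [2+s]q≡0
    ... | inj₂ q≡0 = q≡0

  catalan-quadratic : C ≗ 𝟙 ⊕ X ⊛ C ⊛ C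
  catalan-quadratic = ≗-by-difference (rearrange X C) (λ n → cong -_ (quadratic-defect≗𝟘 n))
    where
    open SeriesSolver
    rearrange : ∀ x c → c ⊕ ⊖ (𝟙 ⊕ x ⊛ c ⊛ c) ≗ ⊖ (x ⊛ c ⊛ c ⊕ ⊖ c ⊕ 𝟙)
    rearrange = solve 2 (λ x c → c :- (con 1ℤ :+ x :* c :* c) := :- (x :* c :* c :- c :+ con 1ℤ)) (λ _ → refl)

module GeometricSeries where

  open import Data.Nat as ℕ using (ℕ; zero; suc)
  import Data.Nat.Properties as ℕ
  open import Data.Nat.Combinatorics using (_C_; nCn≡1)
  open import Data.Integer using (ℤ; +_; 0ℤ; 1ℤ; _+_; _*_; _^_)
  open import Data.Integer.Properties
  open import Data.Integer.Solver using (module +-*-Solver)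
  open import Relation.Binary.PropositionalEquality
  open PowerSeries
  open CatalanNumbers using (pascal)

  geometric : ℤ → Series
  geometric a n = a ^ n

  geometric-linear : ∀ a → geometric a ≗ 𝟙 ⊕ κ a ⊛ (X ⊛ geometric a)
  geometric-linear a zero    = sym (cong (_+_ 1ℤ) (trans (κ-⊛ a (X ⊛ geometric a) 0) (*-zeroʳ a)))
  geometric-linear a (suc m) = sym (trans (+-identityˡ _) (trans (κ-⊛ a (X ⊛ geometric a) (suc m))
                                                                   (cong (a *_) (X⊛-suc (geometric a) m))))

  pow-geometric-step : ∀ a p → pow (geometric a) (suc (suc p)) ≗
                       pow (geometric a) (suc p) ⊕ κ a ⊛ (X ⊛ pow (geometric a) (suc (suc p)))
  pow-geometric-step a p = ≗-by-difference (factor (geometric a) (pow (geometric a) (suc p)) (κ a) X)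
                                           (⊛-≗𝟘 (pow (geometric a) (suc p)) (difference-≗𝟘 (geometric-linear a)))
    where
    open SeriesSolver
    factor : ∀ h q c x → h ⊛ q ⊕ ⊖ (q ⊕ c ⊛ (x ⊛ (h ⊛ q))) ≗ q ⊛ (h ⊕ ⊖ (𝟙 ⊕ c ⊛ (x ⊛ h)))
    factor = solve 4 (λ h q c x → h :* q :- (q :+ c :* (x :* (h :* q))) := q :* (h :- (con 1ℤ :+ c :* (x :* h)))) ≗-refl

  pow-geometric-coefficient : ∀ a p m → pow (geometric a) (suc p) m ≡ + ((m ℕ.+ p) C p) * a ^ m
  pow-geometric-coefficient a zero    m       = trans (⊛-identityʳ (geometric a) m) (sym (*-identityˡ (a ^ m)))
  pow-geometric-coefficient a (suc p) zero    = begin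
    pow (geometric a) (suc (suc p)) 0                                       ≡⟨ pow-geometric-step a p 0 ⟩
    pow (geometric a) (suc p) 0 + (κ a ⊛ (X ⊛ pow (geometric a) (suc (suc p)))) 0
      ≡⟨ cong₂ _+_ (pow-geometric-coefficient a p 0) (trans (κ-⊛ a (X ⊛ pow (geometric a) (suc (suc p))) 0) (*-zeroʳ a)) ⟩
    + (p C p) * 1ℤ + 0ℤ                                                     ≡⟨ cong (λ z → + z * 1ℤ + 0ℤ) (nCn≡1 p) ⟩
    1ℤ                                                                      ≡⟨ cong (λ z → + z * 1ℤ) (nCn≡1 (suc p)) ⟨
    + (suc p C suc p) * 1ℤ                                                  ∎
    where open ≡-Reasoning
  pow-geometric-coefficient a (suc p) (suc m) = begin
    pow (geometric a) (suc (suc p)) (suc m)                                 ≡⟨ pow-geometric-step a p (suc m) ⟩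
    pow (geometric a) (suc p) (suc m) + (κ a ⊛ (X ⊛ pow (geometric a) (suc (suc p)))) (suc m)
      ≡⟨ cong₂ _+_ (pow-geometric-coefficient a p (suc m))
                   (trans (κ-⊛ a _ (suc m)) (cong (a *_) (trans (X⊛-suc _ m) (pow-geometric-coefficient a (suc p) m)))) ⟩
    + ((suc m ℕ.+ p) C p) * (a * a ^ m) + a * (+ (N C suc p) * a ^ m)        ≡⟨ cong (λ z → + (z C p) * (a * a ^ m) + a * (+ (N C suc p) * a ^ m)) (ℕ.+-suc m p) ⟨
    + (N C p) * (a * a ^ m) + a * (+ (N C suc p) * a ^ m)                    ≡⟨ collect (+ (N C p)) (+ (N C suc p)) a (a ^ m) ⟩
    (+ (N C p) + + (N C suc p)) * (a * a ^ m)                                ≡⟨ cong (λ z → z * (a * a ^ m)) (pos-+ (N C p) (N C suc p)) ⟨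
    + (N C p ℕ.+ N C suc p) * (a * a ^ m)                                    ≡⟨ cong (λ z → + z * (a * a ^ m)) (pascal N p) ⟨
    + (suc N C suc p) * (a * a ^ m)                                          ∎
    where
    open ≡-Reasoning
    open +-*-Solver
    N : ℕ
    N = m ℕ.+ suc p
    collect : ∀ x y a b → x * (a * b) + a * (y * b) ≡ (x + y) * (a * b)
    collect = solve 4 (λ x y a b → x :* (a :* b) :+ a :* (y :* b) := (x :+ y) :* (a :* b)) refl

module SchroderSeries (a b : ℤ) where

  open import Data.Nat as ℕ using (ℕ; suc; _≤_; _∸_)
  import Data.Nat.Properties as ℕ
  open import Data.Nat.Combinatorics using (_C_)
  open import Data.Integer as ℤ using (+_; 0ℤ; 1ℤ; _+_; _*_; _^_)
  open import Data.Integer.Properties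
  open import Data.Integer.Solver using (module +-*-Solver)
  open import Relation.Binary.PropositionalEquality
  open import Defs using (S; catalan; sumℤ)
  open IntegerSums
  open PowerSeries
  open GeometricSeries
  open CatalanSeries using (catalanSeries; catalan-quadratic)

  H : Series
  H = geometric a

  -- S_n(a,b) = [xⁿ] H · C(b x H²): the k-th term of the sum is the contribution of C_k (b x H²)ᵏ.
  substituted : Series
  substituted = κ b ⊛ X ⊛ H ⊛ H

  substituted-0 : substituted 0 ≡ 0ℤ
  substituted-0 = cong (λ z → z * a ^ 0 * a ^ 0) (*-zeroʳ b)

  open Substitution substituted substituted-0

  H⊛pow-substituted : ∀ k → H ⊛ pow substituted k ≗ κ (b ^ k) ⊛ (pow X k ⊛ pow H (suc (k ℕ.+ k)))
  H⊛pow-substituted k = begin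
    H ⊛ pow substituted k
      ≈⟨ ⊛-cong (≗-refl {H}) (pow-cong (⊛-assoc (κ b ⊛ X) H H) k) ⟩
    H ⊛ pow ((κ b ⊛ X) ⊛ (H ⊛ H)) k
      ≈⟨ ⊛-cong (≗-refl {H}) (≗-trans (pow-⊛ (κ b ⊛ X) (H ⊛ H) k)
           (⊛-cong (≗-trans (pow-⊛ (κ b) X k) (⊛-cong (pow-κ b k) ≗-refl)) (≗-trans (pow-⊛ H H k) (≗-sym (pow-+ H k k))))) ⟩
    H ⊛ ((κ (b ^ k) ⊛ pow X k) ⊛ pow H (k ℕ.+ k))
      ≈⟨ reassociate H (κ (b ^ k)) (pow X k) (pow H (k ℕ.+ k)) ⟩
    κ (b ^ k) ⊛ (pow X k ⊛ (H ⊛ pow H (k ℕ.+ k))) ∎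
    where
    open ≗-Reasoning
    open SeriesSolver
    reassociate : ∀ h c x p → h ⊛ ((c ⊛ x) ⊛ p) ≗ c ⊛ (x ⊛ (h ⊛ p))
    reassociate = solve 4 (λ h c x p → h :* ((c :* x) :* p) := c :* (x :* (h :* p))) ≗-refl

  term-coefficient : ∀ n k → k ≤ n → catalanSeries k * (H ⊛ pow substituted k) n ≡
                     + (((n ℕ.+ k) C (2 ℕ.* k)) ℕ.* catalan k) * (a ^ (n ∸ k)) * (b ^ k)
  term-coefficient n k k≤n = begin
    Ck * (H ⊛ pow substituted k) n                                  ≡⟨ cong (Ck *_) (H⊛pow-substituted k n) ⟩
    Ck * (κ (b ^ k) ⊛ (pow X k ⊛ pow H (suc (k ℕ.+ k)))) n          ≡⟨ cong (Ck *_) (κ-⊛ (b ^ k) _ n) ⟩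
    Ck * (b ^ k * (pow X k ⊛ pow H (suc (k ℕ.+ k))) n)
      ≡⟨ cong (λ z → Ck * (b ^ k * (pow X k ⊛ pow H (suc (k ℕ.+ k))) z)) (ℕ.m+[n∸m]≡n k≤n) ⟨
    Ck * (b ^ k * (pow X k ⊛ pow H (suc (k ℕ.+ k))) (k ℕ.+ (n ∸ k)))
      ≡⟨ cong (λ z → Ck * (b ^ k * z)) (trans (pow-X⊛ k _ (n ∸ k)) (pow-geometric-coefficient a (k ℕ.+ k) (n ∸ k))) ⟩
    Ck * (b ^ k * (+ (((n ∸ k) ℕ.+ (k ℕ.+ k)) C (k ℕ.+ k)) * a ^ (n ∸ k)))
      ≡⟨ cong₂ (λ u v → Ck * (b ^ k * (+ (u C v) * a ^ (n ∸ k)))) n-k+2k≡n+k k+k≡2k ⟩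
    Ck * (b ^ k * (+ ((n ℕ.+ k) C (2 ℕ.* k)) * a ^ (n ∸ k)))
      ≡⟨ reorder Ck (b ^ k) (+ ((n ℕ.+ k) C (2 ℕ.* k))) (a ^ (n ∸ k)) ⟩
    + ((n ℕ.+ k) C (2 ℕ.* k)) * Ck * (a ^ (n ∸ k)) * (b ^ k)
      ≡⟨ cong (λ z → z * (a ^ (n ∸ k)) * (b ^ k)) (pos-* ((n ℕ.+ k) C (2 ℕ.* k)) (catalan k)) ⟨
    + (((n ℕ.+ k) C (2 ℕ.* k)) ℕ.* catalan k) * (a ^ (n ∸ k)) * (b ^ k) ∎
    where
    open ≡-Reasoning
    open +-*-Solver
    Ck : ℤ
    Ck = catalanSeries k
    reorder : ∀ c B m A → c * (B * (m * A)) ≡ m * c * A * B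
    reorder = solve 4 (λ c B m A → c :* (B :* (m :* A)) := m :* c :* A :* B) refl
    k+k≡2k : k ℕ.+ k ≡ 2 ℕ.* k
    k+k≡2k = cong (k ℕ.+_) (sym (ℕ.+-identityʳ k))
    n-k+2k≡n+k : (n ∸ k) ℕ.+ (k ℕ.+ k) ≡ n ℕ.+ k
    n-k+2k≡n+k = trans (sym (ℕ.+-assoc (n ∸ k) k k)) (cong (ℕ._+ k) (ℕ.m∸n+n≡m k≤n))

  schroderSeries : Series
  schroderSeries n = S n a b

  schroderSeries≗H⊛composite : schroderSeries ≗ H ⊛ compose catalanSeries
  schroderSeries≗H⊛composite n = sym (begin
    (H ⊛ compose catalanSeries) n
      ≡⟨ ⊛-cong-upTo n (λ _ _ → refl) (λ j j≤n → sym (composeUpTo≡compose n catalanSeries j j≤n)) ⟩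
    (H ⊛ composeUpTo n catalanSeries) n                        ≡⟨ ⊛-sumℤ n catalanSeries (pow substituted) H n ⟩
    sumℤ n (λ k → catalanSeries k * (H ⊛ pow substituted k) n) ≡⟨ sumℤ-cong n (term-coefficient n) ⟩
    S n a b ∎)
    where open ≡-Reasoning

  -- Combine H = 1 + a x H with φ = 1 + (b x H²) φ², the equation of φ = C ∘ (b x H²).
  schroderSeries-quadratic : schroderSeries ≗ 𝟙 ⊕ κ a ⊛ X ⊛ schroderSeries ⊕ κ b ⊛ X ⊛ schroderSeries ⊛ schroderSeries
  schroderSeries-quadratic = begin
    schroderSeries                                                     ≈⟨ schroderSeries≗H⊛composite ⟩
    H ⊛ φ                                                              ≈⟨ product-quadratic ⟩
    𝟙 ⊕ κ a ⊛ X ⊛ (H ⊛ φ) ⊕ κ b ⊛ X ⊛ (H ⊛ φ) ⊛ (H ⊛ φ)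
      ≈⟨ ⊕-cong (⊕-cong (≗-refl {𝟙}) (⊛-cong (≗-refl {κ a ⊛ X}) back)) (⊛-cong (⊛-cong (≗-refl {κ b ⊛ X}) back) back) ⟩
    𝟙 ⊕ κ a ⊛ X ⊛ schroderSeries ⊕ κ b ⊛ X ⊛ schroderSeries ⊛ schroderSeries ∎
    where
    open ≗-Reasoning
    φ : Series
    φ = compose catalanSeries
    back : H ⊛ φ ≗ schroderSeries
    back = ≗-sym schroderSeries≗H⊛composite
    open SeriesSolver
    catalan-quadratic′ : catalanSeries ≗ 𝟙 ⊕ κ 0ℤ ⊛ X ⊛ catalanSeries ⊕ κ 1ℤ ⊛ X ⊛ catalanSeries ⊛ catalanSeries
    catalan-quadratic′ = ≗-trans catalan-quadratic (pad X catalanSeries)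
      where
      pad : ∀ x c → 𝟙 ⊕ x ⊛ c ⊛ c ≗ 𝟙 ⊕ κ 0ℤ ⊛ x ⊛ c ⊕ κ 1ℤ ⊛ x ⊛ c ⊛ c
      pad = solve 2 (λ x c → con 1ℤ :+ x :* c :* c := con 1ℤ :+ con 0ℤ :* x :* c :+ con 1ℤ :* x :* c :* c) ≗-refl
    combine : ∀ h p A B x →
      h ⊛ p ⊕ ⊖ (𝟙 ⊕ A ⊛ x ⊛ (h ⊛ p) ⊕ B ⊛ x ⊛ (h ⊛ p) ⊛ (h ⊛ p))
      ≗ (p ⊕ ⊖ (𝟙 ⊕ κ 0ℤ ⊛ (B ⊛ x ⊛ h ⊛ h) ⊛ p ⊕ κ 1ℤ ⊛ (B ⊛ x ⊛ h ⊛ h) ⊛ p ⊛ p)) ⊕ p ⊛ (h ⊕ ⊖ (𝟙 ⊕ A ⊛ (x ⊛ h)))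
    combine = solve 5 (λ h p A B x → h :* p :- (con 1ℤ :+ A :* x :* (h :* p) :+ B :* x :* (h :* p) :* (h :* p))
      := (p :- (con 1ℤ :+ con 0ℤ :* (B :* x :* h :* h) :* p :+ con 1ℤ :* (B :* x :* h :* h) :* p :* p)) :+ p :* (h :- (con 1ℤ :+ A :* (x :* h)))) ≗-refl
    product-quadratic : H ⊛ φ ≗ 𝟙 ⊕ κ a ⊛ X ⊛ (H ⊛ φ) ⊕ κ b ⊛ X ⊛ (H ⊛ φ) ⊛ (H ⊛ φ)
    product-quadratic = ≗-by-difference (combine H φ (κ a) (κ b) X)
      (λ n → cong₂ _+_ (difference-≗𝟘 (compose-quadratic 0ℤ 1ℤ catalanSeries catalan-quadratic′) n)
                       (⊛-≗𝟘 φ (difference-≗𝟘 (geometric-linear a)) n))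

module PathCounting where

  open import Data.Bool using (Bool; true; false; _∧_; not)
  open import Data.Nat as ℕ using (ℕ; zero; suc; _+_; _*_; _∸_; _≡ᵇ_)
  open import Data.Nat.Properties hiding (_≟_)
  open import Algebra.Properties.CommutativeSemigroup +-commutativeSemigroup using (interchange)
  open import Algebra.Properties.Semiring.Sum +-*-semiring
    using (sum-syntax; sum-cong-≗; sum-replicate-zero; *-distribʳ-sum) renaming (sum to ∑)
  open import Data.Fin as Fin using (Fin; _≟_)
  open import Data.List using (List; []; _∷_; map; concatMap; filterᵇ; allFin; tabulate)
  open import Data.List.Properties using (map-++; map-cong; map-tabulate; map-∘)
  open import Data.Nat.ListAction using (sum)
  open import Data.Nat.ListAction.Properties using (sum-++)
  open import Data.Maybe using (Maybe; just; nothing)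
  open import Relation.Nullary.Decidable using (⌊_⌋; yes; no)
  open import Relation.Binary.PropositionalEquality
  open import Function using (_∘_; id)
  open import Defs

  indicator : Bool → ℕ
  indicator true  = 1
  indicator false = 0

  sum-map-+ : ∀ {A : Set} (F G : A → ℕ) xs → sum (map (λ x → F x + G x) xs) ≡ sum (map F xs) + sum (map G xs)
  sum-map-+ F G []       = refl
  sum-map-+ F G (x ∷ xs) = trans (cong (F x + G x +_) (sum-map-+ F G xs)) (interchange (F x) (G x) _ _)

  sum-map-* : ∀ {A : Set} k (F : A → ℕ) xs → sum (map (λ x → k * F x) xs) ≡ k * sum (map F xs)
  sum-map-* k F []       = sym (*-zeroʳ k)
  sum-map-* k F (x ∷ xs) = trans (cong (k * F x +_) (sum-map-* k F xs)) (sym (*-distribˡ-+ k (F x) _))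

  sum-map-concatMap : ∀ {A B : Set} (F : B → ℕ) (g : A → List B) xs →
                      sum (map F (concatMap g xs)) ≡ sum (map (λ x → sum (map F (g x))) xs)
  sum-map-concatMap F g []       = refl
  sum-map-concatMap F g (x ∷ xs) = trans (cong sum (map-++ F (g x) (concatMap g xs)))
    (trans (sum-++ (map F (g x)) _) (cong (sum (map F (g x)) +_) (sum-map-concatMap F g xs)))

  sum-map-filter : ∀ {A : Set} (p : A → Bool) (g : A → ℕ) xs →
                   sum (map g (filterᵇ p xs)) ≡ sum (map (λ x → indicator (p x) * g x) xs)
  sum-map-filter p g []       = refl
  sum-map-filter p g (x ∷ xs) with p x
  ... | true  = cong₂ _+_ (sym (+-identityʳ (g x))) (sum-map-filter p g xs)
  ... | false = sum-map-filter p g xs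

  sum-tabulate : ∀ n (g : Fin n → ℕ) → sum (tabulate g) ≡ ∑ g
  sum-tabulate zero    g = refl
  sum-tabulate (suc n) g = cong (g Fin.zero +_) (sum-tabulate n (g ∘ Fin.suc))

  total : ∀ r → ℕ → (List (Step r) → ℕ) → ℕ
  total r m F = sum (map F (words r m))

  total-suc : ∀ r m F → total r (suc m) F ≡ total r m (λ w → F (u ∷ w) + ∑[ c < r ] F (d c ∷ w))
  total-suc r m F = trans (sum-map-concatMap F _ (words r m))
    (cong sum (map-cong (λ w → cong (F (u ∷ w) +_) (trans (cong sum (down-steps w)) (sum-tabulate r _))) (words r m)))
    where
    down-steps : ∀ w → map F (map (_∷ w) (map d (allFin r))) ≡ tabulate (λ c → F (d c ∷ w))
    down-steps w = trans (sym (map-∘ (map d (allFin r)))) (trans (sym (map-∘ (allFin r))) (map-tabulate id _))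

  total-cong : ∀ r m {F G} → (∀ w → F w ≡ G w) → total r m F ≡ total r m G
  total-cong r m F≡G = cong sum (map-cong F≡G (words r m))

  total-+ : ∀ r m F G → total r m (λ w → F w + G w) ≡ total r m F + total r m G
  total-+ r m F G = sum-map-+ F G (words r m)

  total-* : ∀ r m k F → total r m (λ w → k * F w) ≡ k * total r m F
  total-* r m k F = sum-map-* k F (words r m)

  total-∑ : ∀ r m n (G : Fin n → List (Step r) → ℕ) → total r m (λ w → ∑[ c < n ] G c w) ≡ ∑[ c < n ] total r m (G c)
  total-∑ r m zero    G = sum-map-* 0 (λ _ → 0) (words r m)
  total-∑ r m (suc n) G = trans (total-+ r m (G Fin.zero) _) (cong (total r m (G Fin.zero) +_) (total-∑ r m n (G ∘ Fin.suc)))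

  -- σ is the colour of the step just before w, if that step was a d-step.
  allowed : ∀ {r} → Maybe (Fin r) → Fin r → Bool
  allowed nothing   c = true
  allowed (just c₀) c = not ⌊ c₀ ≟ c ⌋

  noRepeatAfter : ∀ {r} → Maybe (Fin r) → List (Step r) → Bool
  noRepeatAfter σ []      = true
  noRepeatAfter σ (u ∷ w) = noRepeatAfter nothing w
  noRepeatAfter σ (d c ∷ w) = allowed σ c ∧ noRepeatAfter (just c) w

  mutual
    noSameConsecD≡noRepeatAfter : ∀ {r} (w : List (Step r)) → noSameConsecD w ≡ noRepeatAfter nothing w
    noSameConsecD≡noRepeatAfter []        = refl
    noSameConsecD≡noRepeatAfter (u ∷ w)   = noSameConsecD≡noRepeatAfter w
    noSameConsecD≡noRepeatAfter (d c ∷ w) = noSameConsecD-d c w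

    noSameConsecD-d : ∀ {r} (c : Fin r) (w : List (Step r)) → noSameConsecD (d c ∷ w) ≡ noRepeatAfter (just c) w
    noSameConsecD-d c []         = refl
    noSameConsecD-d c (u ∷ w)    = noSameConsecD≡noRepeatAfter w
    noSameConsecD-d c (d c′ ∷ w) = cong (not ⌊ c ≟ c′ ⌋ ∧_) (noSameConsecD-d c′ w)

  admissible : ∀ {r} → ℕ → Maybe (Fin r) → List (Step r) → Bool
  admissible h σ w = dyckFrom h w ∧ noRepeatAfter σ w

  admissible-u : ∀ {r} h σ (w : List (Step r)) → admissible h σ (u ∷ w) ≡ admissible (suc h) nothing w
  admissible-u zero    σ w = refl
  admissible-u (suc h) σ w = refl

  admissible-d : ∀ {r} h σ c (w : List (Step r)) →
                 indicator (admissible (suc h) σ (d c ∷ w)) ≡ indicator (allowed σ c) * indicator (admissible h (just c) w)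
  admissible-d h σ c w with dyckFrom h w | allowed σ c
  ... | true  | true  = sym (+-identityʳ _)
  ... | true  | false = refl
  ... | false | true  = sym (+-identityʳ _)
  ... | false | false = refl

  afterUp : ∀ {r} → Maybe (Fin r) → Bool
  afterUp nothing  = true
  afterUp (just _) = false

  colourChoices : ℕ → Bool → ℕ
  colourChoices r true  = r
  colourChoices r false = r ∸ 1

  count-allowed : ∀ r σ → ∑[ c < r ] indicator (allowed σ c) ≡ colourChoices r (afterUp σ)
  count-allowed r       nothing   = all-allowed r
    where
    all-allowed : ∀ r → ∑[ c < r ] indicator (allowed {r} nothing c) ≡ r
    all-allowed zero    = refl
    all-allowed (suc r) = cong suc (all-allowed r)
  count-allowed (suc r) (just c₀) = all-but-one r c₀
    where
    all-but-one : ∀ r (c₀ : Fin (suc r)) → ∑[ c < suc r ] indicator (not ⌊ c₀ ≟ c ⌋) ≡ r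
    all-but-one r       Fin.zero     = count-allowed r nothing
    all-but-one (suc r) (Fin.suc c₀) = cong suc (trans (sum-cong-≗ (λ c → cong (indicator ∘ not) (suc-≟ c₀ c))) (all-but-one r c₀))
      where
      suc-≟ : ∀ {n} (a b : Fin n) → ⌊ Fin.suc a ≟ Fin.suc b ⌋ ≡ ⌊ a ≟ b ⌋
      suc-≟ a b with a ≟ b
      ... | yes refl = refl
      ... | no _     = refl

  total-after-d : ∀ r m σ (G : Fin r → List (Step r) → ℕ) v → (∀ c → total r m (G c) ≡ v) →
                  total r m (λ w → ∑[ c < r ] (indicator (allowed σ c) * G c w)) ≡ colourChoices r (afterUp σ) * v
  total-after-d r m σ G v total-G≡v = begin
    total r m (λ w → ∑[ c < r ] (indicator (allowed σ c) * G c w))   ≡⟨ total-∑ r m r _ ⟩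
    ∑[ c < r ] total r m (λ w → indicator (allowed σ c) * G c w)
      ≡⟨ sum-cong-≗ (λ c → trans (total-* r m (indicator (allowed σ c)) (G c)) (cong (indicator (allowed σ c) *_) (total-G≡v c))) ⟩
    ∑[ c < r ] (indicator (allowed σ c) * v)                         ≡⟨ *-distribʳ-sum v (indicator ∘ allowed σ) ⟨
    ∑[ c < r ] indicator (allowed σ c) * v                           ≡⟨ cong (_* v) (count-allowed r σ) ⟩
    colourChoices r (afterUp σ) * v                                  ∎
    where open ≡-Reasoning

  -- Admissible continuations of length m from height h; the flag says whether the previous step was not a d-step.
  suffixes : ℕ → Bool → ℕ → ℕ → ℕ
  suffixes r b zero    zero    = 1
  suffixes r b (suc h) zero    = 0
  suffixes r b zero    (suc m) = suffixes r true 1 m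
  suffixes r b (suc h) (suc m) = suffixes r true (suc (suc h)) m + colourChoices r b * suffixes r false h m

  count-admissible : ∀ r m h σ → total r m (indicator ∘ admissible h σ) ≡ suffixes r (afterUp σ) h m
  count-admissible r zero    zero    σ = refl
  count-admissible r zero    (suc h) σ = refl
  count-admissible r (suc m) zero    σ = trans (total-suc r m _)
    (trans (total-cong r m (λ w → trans (cong₂ _+_ (cong indicator (admissible-u 0 σ w)) (sum-replicate-zero r)) (+-identityʳ _)))
           (count-admissible r m 1 nothing))
  count-admissible r (suc m) (suc h) σ = begin
    total r (suc m) (indicator ∘ admissible (suc h) σ)
      ≡⟨ total-suc r m _ ⟩
    total r m (λ w → indicator (admissible (suc h) σ (u ∷ w)) + ∑[ c < r ] indicator (admissible (suc h) σ (d c ∷ w)))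
      ≡⟨ total-+ r m _ _ ⟩
    total r m (λ w → indicator (admissible (suc h) σ (u ∷ w))) + total r m (λ w → ∑[ c < r ] indicator (admissible (suc h) σ (d c ∷ w)))
      ≡⟨ cong₂ _+_ (trans (total-cong r m (λ w → cong indicator (admissible-u (suc h) σ w))) (count-admissible r m (suc (suc h)) nothing))
                   (trans (total-cong r m (λ w → sum-cong-≗ (λ c → admissible-d h σ c w)))
                          (total-after-d r m σ _ _ (λ c → count-admissible r m h (just c)))) ⟩
    suffixes r true (suc (suc h)) m + colourChoices r (afterUp σ) * suffixes r false h m ∎
    where open ≡-Reasoning

  arrivals : ℕ → ℕ → ℕ → ℕ → ℕ
  arrivals r L h m = indicator (suc h ≡ᵇ L) * suffixes r true (suc h) m

  -- Total number of u-steps ending at level L over all admissible continuations (flag as for suffixes).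
  upSteps : ℕ → ℕ → Bool → ℕ → ℕ → ℕ
  upSteps r L b h       zero    = 0
  upSteps r L b zero    (suc m) = arrivals r L 0 m + upSteps r L true 1 m
  upSteps r L b (suc h) (suc m) = arrivals r L (suc h) m + upSteps r L true (suc (suc h)) m + colourChoices r b * upSteps r L false h m

  weightedTotal : ∀ r → ℕ → ℕ → Maybe (Fin r) → ℕ → ℕ
  weightedTotal r L h σ m = total r m (λ w → indicator (admissible h σ w) * uAtFrom L h w)

  uAtFrom-u : ∀ {r} L h (w : List (Step r)) → uAtFrom L h (u ∷ w) ≡ indicator (suc h ≡ᵇ L) + uAtFrom L (suc h) w
  uAtFrom-u L h w with suc h ≡ᵇ L
  ... | true  = refl
  ... | false = refl

  weightedTotal-u : ∀ r L m h σ →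
    total r m (λ w → indicator (admissible h σ (u ∷ w)) * uAtFrom L h (u ∷ w)) ≡ arrivals r L h m + weightedTotal r L (suc h) nothing m
  weightedTotal-u r L m h σ = begin
    total r m (λ w → indicator (admissible h σ (u ∷ w)) * uAtFrom L h (u ∷ w))
      ≡⟨ total-cong r m (λ w → trans (cong₂ _*_ (cong indicator (admissible-u h σ w)) (uAtFrom-u L h w))
                                     (trans (*-distribˡ-+ (valid w) _ _) (cong (_+ valid w * uAtFrom L (suc h) w) (*-comm (valid w) _)))) ⟩
    total r m (λ w → indicator (suc h ≡ᵇ L) * valid w + valid w * uAtFrom L (suc h) w)
      ≡⟨ total-+ r m _ _ ⟩
    total r m (λ w → indicator (suc h ≡ᵇ L) * valid w) + weightedTotal r L (suc h) nothing m
      ≡⟨ cong (_+ weightedTotal r L (suc h) nothing m)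
              (trans (total-* r m (indicator (suc h ≡ᵇ L)) valid) (cong (indicator (suc h ≡ᵇ L) *_) (count-admissible r m (suc h) nothing))) ⟩
    arrivals r L h m + weightedTotal r L (suc h) nothing m ∎
    where
    open ≡-Reasoning
    valid : List (Step r) → ℕ
    valid w = indicator (admissible (suc h) nothing w)

  weightedTotal≡upSteps : ∀ r L m h σ → weightedTotal r L h σ m ≡ upSteps r L (afterUp σ) h m
  weightedTotal≡upSteps r L zero    h       σ = trans (+-identityʳ _) (*-zeroʳ (indicator (admissible h σ [])))
  weightedTotal≡upSteps r L (suc m) zero    σ = begin
    weightedTotal r L 0 σ (suc m)
      ≡⟨ total-suc r m _ ⟩
    total r m (λ w → indicator (admissible 0 σ (u ∷ w)) * uAtFrom L 0 (u ∷ w) + ∑[ c < r ] 0)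
      ≡⟨ total-cong r m (λ w → trans (cong (indicator (admissible 0 σ (u ∷ w)) * uAtFrom L 0 (u ∷ w) +_) (sum-replicate-zero r)) (+-identityʳ _)) ⟩
    total r m (λ w → indicator (admissible 0 σ (u ∷ w)) * uAtFrom L 0 (u ∷ w))
      ≡⟨ weightedTotal-u r L m 0 σ ⟩
    arrivals r L 0 m + weightedTotal r L 1 nothing m
      ≡⟨ cong (arrivals r L 0 m +_) (weightedTotal≡upSteps r L m 1 nothing) ⟩
    upSteps r L (afterUp σ) 0 (suc m) ∎
    where open ≡-Reasoning
  weightedTotal≡upSteps r L (suc m) (suc h) σ = begin
    weightedTotal r L (suc h) σ (suc m)
      ≡⟨ trans (total-suc r m _) (total-+ r m _ _) ⟩
    total r m (λ w → indicator (admissible (suc h) σ (u ∷ w)) * uAtFrom L (suc h) (u ∷ w))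
      + total r m (λ w → ∑[ c < r ] (indicator (admissible (suc h) σ (d c ∷ w)) * uAtFrom L h w))
      ≡⟨ cong₂ _+_ (trans (weightedTotal-u r L m (suc h) σ) (cong (arrivals r L (suc h) m +_) (weightedTotal≡upSteps r L m (suc (suc h)) nothing)))
                   (trans (total-cong r m (λ w → sum-cong-≗ (λ c → trans (cong (_* uAtFrom L h w) (admissible-d h σ c w))
                                                                     (*-assoc (indicator (allowed σ c)) (indicator (admissible h (just c) w)) (uAtFrom L h w)))))
                          (total-after-d r m σ _ _ (λ c → weightedTotal≡upSteps r L m h (just c)))) ⟩
    arrivals r L (suc h) m + upSteps r L true (suc (suc h)) m + colourChoices r (afterUp σ) * upSteps r L false h m ∎
    where open ≡-Reasoning

  U≡upSteps : ∀ r n ℓ → U r n ℓ ≡ upSteps r (suc ℓ) true 0 (2 * suc n)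
  U≡upSteps r n ℓ = trans (sum-map-filter _ (uAt (suc ℓ)) (words r (2 * suc n)))
    (trans (total-cong r (2 * suc n) (λ w → cong (λ z → indicator (dyckFrom 0 w ∧ z) * uAtFrom (suc ℓ) 0 w) (noSameConsecD≡noRepeatAfter w)))
           (weightedTotal≡upSteps r (suc ℓ) (2 * suc n) 0 nothing))

module FirstPassage where

  open import Data.Bool using (true; false)
  open import Data.Nat as ℕ using (ℕ; zero; suc; _+_; _*_; _∸_; _≡ᵇ_; _≤_; _<_; s≤s; _<?_)
  open import Data.Nat.Properties hiding (_≟_)
  open import Data.Nat.Solver using (module +-*-Solver)
  open import Relation.Binary.PropositionalEquality
  open import Relation.Nullary using (Dec; yes; no)
  open import Function using (_∘_)
  open PathCounting using (indicator; suffixes; arrivals; upSteps)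

  -- Admissible coloured prefixes of length i from height 0 to height k whose last step is not (U) or is (D) a d-step.
  mutual
    prefixesU : ℕ → ℕ → ℕ → ℕ
    prefixesU r zero    zero    = 1
    prefixesU r (suc k) zero    = 0
    prefixesU r zero    (suc i) = 0
    prefixesU r (suc k) (suc i) = prefixes r k i

    prefixesD : ℕ → ℕ → ℕ → ℕ
    prefixesD r k zero    = 0
    prefixesD r k (suc i) = r * prefixesU r (suc k) i + (r ∸ 1) * prefixesD r (suc k) i

    prefixes : ℕ → ℕ → ℕ → ℕ
    prefixes r k i = prefixesU r k i + prefixesD r k i

  mutual
    prefixesU-vanishes : ∀ r k i → i < k → prefixesU r k i ≡ 0
    prefixesU-vanishes r (suc k) zero    _         = refl
    prefixesU-vanishes r (suc k) (suc i) (s≤s i<k) = prefixes-vanishes r k i i<k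

    prefixesD-vanishes : ∀ r k i → i ≤ suc k → prefixesD r k i ≡ 0
    prefixesD-vanishes r k zero    _         = refl
    prefixesD-vanishes r k (suc i) (s≤s i≤k) =
      cong₂ _+_ (trans (cong (r *_) (prefixesU-vanishes r (suc k) i (s≤s i≤k))) (*-zeroʳ r))
                (trans (cong ((r ∸ 1) *_) (prefixesD-vanishes r (suc k) i (m≤n⇒m≤1+n (m≤n⇒m≤1+n i≤k)))) (*-zeroʳ (r ∸ 1)))

    prefixes-vanishes : ∀ r k i → i < k → prefixes r k i ≡ 0
    prefixes-vanishes r k i i<k =
      cong₂ _+_ (prefixesU-vanishes r k i i<k) (prefixesD-vanishes r k i (m≤n⇒m≤1+n (<⇒≤ i<k)))

  sumBelow : ℕ → (ℕ → ℕ) → ℕ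
  sumBelow zero    f = 0
  sumBelow (suc n) f = f 0 + sumBelow n (f ∘ suc)

  sumBelow-cong : ∀ n {f g} → (∀ h → f h ≡ g h) → sumBelow n f ≡ sumBelow n g
  sumBelow-cong zero    f≡g = refl
  sumBelow-cong (suc n) f≡g = cong₂ _+_ (f≡g 0) (sumBelow-cong n (f≡g ∘ suc))

  sumBelow-+ : ∀ n f g → sumBelow n (λ h → f h + g h) ≡ sumBelow n f + sumBelow n g
  sumBelow-+ zero    f g = refl
  sumBelow-+ (suc n) f g = trans (cong (f 0 + g 0 +_) (sumBelow-+ n (f ∘ suc) (g ∘ suc))) (interchange (f 0) (g 0) _ _)
    where open import Algebra.Properties.CommutativeSemigroup +-commutativeSemigroup using (interchange)

  sumBelow-snoc : ∀ n f → sumBelow (suc n) f ≡ sumBelow n f + f n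
  sumBelow-snoc zero    f = +-identityʳ (f 0)
  sumBelow-snoc (suc n) f = trans (cong (f 0 +_) (sumBelow-snoc n (f ∘ suc))) (sym (+-assoc (f 0) _ _))

  sumBelow-zero : ∀ n f → (∀ h → f h ≡ 0) → sumBelow n f ≡ 0
  sumBelow-zero zero    f f≡0 = refl
  sumBelow-zero (suc n) f f≡0 = cong₂ _+_ (f≡0 0) (sumBelow-zero n (f ∘ suc) (f≡0 ∘ suc))

  sumBelow-select : ∀ n ℓ (g : ℕ → ℕ) → ℓ < n → sumBelow n (λ h → indicator (h ≡ᵇ ℓ) * g h) ≡ g ℓ
  sumBelow-select (suc n) zero    g _ =
    trans (cong₂ _+_ (+-identityʳ (g 0)) (sumBelow-zero n (λ h → 0 * g (suc h)) (λ h → refl))) (+-identityʳ (g 0))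
  sumBelow-select (suc n) (suc ℓ) g (s≤s ℓ<n) = sumBelow-select n ℓ (g ∘ suc) ℓ<n

  sumBelow-select-none : ∀ n ℓ (g : ℕ → ℕ) → n ≤ ℓ → sumBelow n (λ h → indicator (h ≡ᵇ ℓ) * g h) ≡ 0
  sumBelow-select-none zero    ℓ       g _         = refl
  sumBelow-select-none (suc n) (suc ℓ) g (s≤s n≤ℓ) = sumBelow-select-none n ℓ (g ∘ suc) n≤ℓ

  module _ (r L : ℕ) where

    -- Paths of length i + m cut after i steps: prefix (ending at h) times the up-steps of the suffix.
    splitAt : ℕ → ℕ → ℕ
    splitAt i m = sumBelow (suc i) (λ h → prefixesU r h i * upSteps r L true h m + prefixesD r h i * upSteps r L false h m)

    arrivalsAt : ℕ → ℕ → ℕ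
    arrivalsAt i m = sumBelow (suc i) (λ h → prefixes r h i * arrivals r L h m)

    private
      afterDown : ℕ → ℕ → ℕ → ℕ
      afterDown i m zero    = 0
      afterDown i m (suc h) = prefixesD r h (suc i) * upSteps r L false h m

    splitAt-summand : ∀ i m h →
      prefixesU r h i * upSteps r L true h (suc m) + prefixesD r h i * upSteps r L false h (suc m)
      ≡ (prefixes r h i * arrivals r L h m + prefixes r h i * upSteps r L true (suc h) m) + afterDown i m h
    splitAt-summand i m zero    = distribute-sum (prefixesU r 0 i) (prefixesD r 0 i) (arrivals r L 0 m) (upSteps r L true 1 m)
      where
      open +-*-Solver
      distribute-sum : ∀ a b s y → a * (s + y) + b * (s + y) ≡ ((a + b) * s + (a + b) * y) + 0
      distribute-sum = solve 4 (λ a b s y → a :* (s :+ y) :+ b :* (s :+ y) := ((a :+ b) :* s :+ (a :+ b) :* y) :+ con 0) refl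
    splitAt-summand i m (suc h) =
      distribute (prefixesU r (suc h) i) (prefixesD r (suc h) i) (arrivals r L (suc h) m) (upSteps r L true (suc (suc h)) m) (upSteps r L false h m) r (r ∸ 1)
      where
      open +-*-Solver
      distribute : ∀ a b s y z r q → a * (s + y + r * z) + b * (s + y + q * z) ≡ ((a + b) * s + (a + b) * y) + (r * a + q * b) * z
      distribute = solve 7 (λ a b s y z r q → a :* (s :+ y :+ r :* z) :+ b :* (s :+ y :+ q :* z)
                                           := ((a :+ b) :* s :+ (a :+ b) :* y) :+ (r :* a :+ q :* b) :* z) refl

    sumBelow-afterDown : ∀ i m → sumBelow (suc i) (afterDown i m) ≡ sumBelow (suc (suc i)) (λ h → prefixesD r h (suc i) * upSteps r L false h m)
    sumBelow-afterDown i m = begin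
      sumBelow i D                                       ≡⟨ +-identityʳ _ ⟨
      sumBelow i D + 0                                   ≡⟨ cong (sumBelow i D +_) (cong₂ _+_ (top i ≤-refl) (top (suc i) (n≤1+n (suc i)))) ⟨
      sumBelow i D + (D i + D (suc i))                   ≡⟨ +-assoc (sumBelow i D) (D i) (D (suc i)) ⟨
      sumBelow i D + D i + D (suc i)                     ≡⟨ cong (_+ D (suc i)) (sumBelow-snoc i D) ⟨
      sumBelow (suc i) D + D (suc i)                     ≡⟨ sumBelow-snoc (suc i) D ⟨
      sumBelow (suc (suc i)) D                           ∎
      where
      open ≡-Reasoning
      D : ℕ → ℕ
      D h = prefixesD r h (suc i) * upSteps r L false h m
      top : ∀ h → suc i ≤ suc h → D h ≡ 0
      top h i≤h = cong (_* upSteps r L false h m) (prefixesD-vanishes r h (suc i) i≤h)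

    splitAt-step : ∀ i m → splitAt i (suc m) ≡ arrivalsAt i m + splitAt (suc i) m
    splitAt-step i m = begin
      splitAt i (suc m)
        ≡⟨ sumBelow-cong (suc i) (splitAt-summand i m) ⟩
      sumBelow (suc i) (λ h → (P h * arrivals r L h m + P h * upSteps r L true (suc h) m) + afterDown i m h)
        ≡⟨ trans (sumBelow-+ (suc i) (λ h → P h * arrivals r L h m + P h * upSteps r L true (suc h) m) (afterDown i m))
                 (cong (_+ sumBelow (suc i) (afterDown i m)) (sumBelow-+ (suc i) (λ h → P h * arrivals r L h m) (λ h → P h * upSteps r L true (suc h) m))) ⟩
      (arrivalsAt i m + sumBelow (suc i) (λ h → P h * upSteps r L true (suc h) m)) + sumBelow (suc i) (afterDown i m)
        ≡⟨ +-assoc (arrivalsAt i m) (sumBelow (suc i) (λ h → P h * upSteps r L true (suc h) m)) (sumBelow (suc i) (afterDown i m)) ⟩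
      arrivalsAt i m + (sumBelow (suc i) (λ h → P h * upSteps r L true (suc h) m) + sumBelow (suc i) (afterDown i m))
        ≡⟨ cong (λ z → arrivalsAt i m + (sumBelow (suc i) (λ h → P h * upSteps r L true (suc h) m) + z)) (sumBelow-afterDown i m) ⟩
      arrivalsAt i m + (sumBelow (suc i) (λ h → P h * upSteps r L true (suc h) m) + sumBelow (suc (suc i)) (λ h → prefixesD r h (suc i) * upSteps r L false h m))
        ≡⟨ cong (arrivalsAt i m +_) (sumBelow-+ (suc (suc i)) (λ h → prefixesU r h (suc i) * upSteps r L true h m)
                                                              (λ h → prefixesD r h (suc i) * upSteps r L false h m)) ⟨
      arrivalsAt i m + splitAt (suc i) m ∎
      where
      open ≡-Reasoning
      P : ℕ → ℕ
      P h = prefixes r h i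

  convolveℕ : (ℕ → ℕ) → (ℕ → ℕ) → ℕ → ℕ
  convolveℕ P A zero    = 0
  convolveℕ P A (suc m) = P 0 * A m + convolveℕ (P ∘ suc) A m

  convolveℕ-cong : ∀ m {P P′} A → (∀ t → P t ≡ P′ t) → convolveℕ P A m ≡ convolveℕ P′ A m
  convolveℕ-cong zero    A P≡P′ = refl
  convolveℕ-cong (suc m) A P≡P′ = cong₂ _+_ (cong (_* A m) (P≡P′ 0)) (convolveℕ-cong m A (P≡P′ ∘ suc))

  module _ (r ℓ : ℕ) where

    arrivalsAt-level : ∀ i m → arrivalsAt r (suc ℓ) i m ≡ prefixes r ℓ i * suffixes r true (suc ℓ) m
    arrivalsAt-level i m = trans (sumBelow-cong (suc i) reorder) (select (ℓ <? suc i))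
      where
      open import Algebra.Properties.CommutativeSemigroup *-commutativeSemigroup using (x∙yz≈y∙xz)
      g : ℕ → ℕ
      g h = prefixes r h i * suffixes r true (suc h) m
      reorder : ∀ h → prefixes r h i * arrivals r (suc ℓ) h m ≡ indicator (h ≡ᵇ ℓ) * g h
      reorder h = x∙yz≈y∙xz (prefixes r h i) (indicator (h ≡ᵇ ℓ)) (suffixes r true (suc h) m)
      select : Dec (ℓ < suc i) → sumBelow (suc i) (λ h → indicator (h ≡ᵇ ℓ) * g h) ≡ g ℓ
      select (yes ℓ<1+i) = sumBelow-select (suc i) ℓ g ℓ<1+i
      select (no  ℓ≮1+i) = trans (sumBelow-select-none (suc i) ℓ g (≤-pred (≰⇒> ℓ≮1+i)))
                                 (sym (cong (_* suffixes r true (suc ℓ) m) (prefixes-vanishes r ℓ i (≤-pred (≰⇒> ℓ≮1+i)))))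

    splitAt-convolution : ∀ m i → splitAt r (suc ℓ) i m ≡ convolveℕ (λ t → prefixes r ℓ (i + t)) (suffixes r true (suc ℓ)) m
    splitAt-convolution zero    i = sumBelow-zero (suc i) _ (λ h → cong₂ _+_ (*-zeroʳ (prefixesU r h i)) (*-zeroʳ (prefixesD r h i)))
    splitAt-convolution (suc m) i = trans (splitAt-step r (suc ℓ) i m)
      (cong₂ _+_ (trans (arrivalsAt-level i m) (cong (λ z → prefixes r ℓ z * suffixes r true (suc ℓ) m) (sym (+-identityʳ i))))
                 (trans (splitAt-convolution m (suc i)) (convolveℕ-cong m _ (λ t → cong (prefixes r ℓ) (sym (+-suc i t))))))

    -- First-passage decomposition: an up-step to level ℓ + 1 at position t + 1 splits the path there.
    upSteps-convolution : ∀ m → upSteps r (suc ℓ) true 0 m ≡ convolveℕ (prefixes r ℓ) (suffixes r true (suc ℓ)) m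
    upSteps-convolution m = trans (sym (trans (+-identityʳ _) (trans (+-identityʳ _) (+-identityʳ _)))) (splitAt-convolution m 0)

module Signs where

  open import Data.Nat as ℕ using (ℕ; zero; suc; _≤_; _∸_)
  import Data.Nat.Properties as ℕ
  open import Data.Nat.Combinatorics using (_C_)
  open import Data.Integer as ℤ using (ℤ; +_; -[1+_]; 1ℤ; _*_; -_; _^_)
  open import Data.Integer.Properties
  open import Data.Integer.Solver using (module +-*-Solver)
  open import Relation.Binary.PropositionalEquality
  open import Defs using (S; catalan)
  open IntegerSums
  open +-*-Solver

  sgnℤ : ℕ → ℤ
  sgnℤ zero    = 1ℤ
  sgnℤ (suc l) = - sgnℤ l

  -1^≡sgnℤ : ∀ j → -[1+ 0 ] ^ j ≡ sgnℤ j
  -1^≡sgnℤ zero    = refl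
  -1^≡sgnℤ (suc j) = trans (-1*i≡-i (-[1+ 0 ] ^ j)) (cong -_ (-1^≡sgnℤ j))

  neg-^ : ∀ j b → (- b) ^ j ≡ sgnℤ j * b ^ j
  neg-^ zero    b = refl
  neg-^ (suc j) b = trans (cong ((- b) *_) (neg-^ j b))
                          (solve 3 (λ b s p → (:- b) :* (s :* p) := (:- s) :* (b :* p)) refl b (sgnℤ j) (b ^ j))

  sgnℤ-+ : ∀ a c → sgnℤ (a ℕ.+ c) ≡ sgnℤ a * sgnℤ c
  sgnℤ-+ zero    c = sym (*-identityˡ (sgnℤ c))
  sgnℤ-+ (suc a) c = trans (cong -_ (sgnℤ-+ a c)) (neg-distribˡ-* (sgnℤ a) (sgnℤ c))

  sgnℤ*sgnℤ : ∀ j → sgnℤ j * sgnℤ j ≡ 1ℤ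
  sgnℤ*sgnℤ zero    = refl
  sgnℤ*sgnℤ (suc j) = trans (solve 1 (λ s → (:- s) :* (:- s) := s :* s) refl (sgnℤ j)) (sgnℤ*sgnℤ j)

  -- Term by term, (−1)^(m−k) = (−1)^m (−1)^k.
  S-at-−1 : ∀ m b → S m -[1+ 0 ] b ≡ sgnℤ m * S m 1ℤ (- b)
  S-at-−1 m b = trans (sumℤ-cong m term) (*-distribˡ-sumℤ m (sgnℤ m) _)
    where
    term : ∀ j → j ≤ m → + (((m ℕ.+ j) C (2 ℕ.* j)) ℕ.* catalan j) * (-[1+ 0 ] ^ (m ∸ j)) * (b ^ j)
                     ≡ sgnℤ m * (+ (((m ℕ.+ j) C (2 ℕ.* j)) ℕ.* catalan j) * (1ℤ ^ (m ∸ j)) * ((- b) ^ j))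
    term j j≤m = begin
      N * (-[1+ 0 ] ^ (m ∸ j)) * (b ^ j)                   ≡⟨ cong (λ z → N * z * (b ^ j)) (-1^≡sgnℤ (m ∸ j)) ⟩
      N * sgnℤ (m ∸ j) * (b ^ j)                           ≡⟨ solve 3 (λ N s p → N :* s :* p := con 1ℤ :* (s :* N :* p)) refl N (sgnℤ (m ∸ j)) (b ^ j) ⟩
      1ℤ * (sgnℤ (m ∸ j) * N * b ^ j)                      ≡⟨ cong (_* (sgnℤ (m ∸ j) * N * b ^ j)) (sgnℤ*sgnℤ j) ⟨
      sgnℤ j * sgnℤ j * (sgnℤ (m ∸ j) * N * b ^ j)
        ≡⟨ solve 4 (λ N s p t → t :* t :* (s :* N :* p) := s :* t :* (N :* con 1ℤ :* (t :* p))) refl N (sgnℤ (m ∸ j)) (b ^ j) (sgnℤ j) ⟩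
      sgnℤ (m ∸ j) * sgnℤ j * (N * 1ℤ * (sgnℤ j * b ^ j))
        ≡⟨ cong₂ (λ u v → u * (N * v * (sgnℤ j * b ^ j))) (sym (trans (cong sgnℤ (sym (ℕ.m∸n+n≡m j≤m))) (sgnℤ-+ (m ∸ j) j))) (sym (^-zeroˡ (m ∸ j))) ⟩
      sgnℤ m * (N * (1ℤ ^ (m ∸ j)) * (sgnℤ j * b ^ j))     ≡⟨ cong (λ z → sgnℤ m * (N * (1ℤ ^ (m ∸ j)) * z)) (neg-^ j b) ⟨
      sgnℤ m * (N * (1ℤ ^ (m ∸ j)) * ((- b) ^ j))          ∎
      where
      open ≡-Reasoning
      N : ℤ
      N = + (((m ℕ.+ j) C (2 ℕ.* j)) ℕ.* catalan j)

module IntegerToRational where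

  open import Data.Nat as ℕ using (ℕ; zero; suc)
  import Data.Nat.Properties as ℕ
  open import Data.Integer as ℤ using (ℤ; +_)
  import Data.Integer.Properties as ℤ
  open import Data.Integer.Solver using (module +-*-Solver)
  open import Data.Rational as ℚ using (ℚ; _+_; _*_; -_; _/_; 1ℚ)
  open import Data.Rational.Properties using (toℚᵘ-injective; toℚᵘ-homo-+; toℚᵘ-homo-*; toℚᵘ-homo‿-; toℚᵘ-fromℚᵘ)
  import Data.Rational.Unnormalised as ℚᵘ
  import Data.Rational.Unnormalised.Properties as ℚᵘ
  open import Relation.Binary.PropositionalEquality
  open import Defs using (toℚ; sumℚ; sumℤ; sgn; δ0)
  open Signs using (sgnℤ)
  open +-*-Solver

  private
    integral : ℤ → ℚᵘ.ℚᵘ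
    integral a = ℚᵘ.mkℚᵘ a 0

    toℚᵘ-toℚ : ∀ a → ℚ.toℚᵘ (toℚ a) ℚᵘ.≃ integral a
    toℚᵘ-toℚ a = toℚᵘ-fromℚᵘ (integral a)

  toℚ-+ : ∀ a b → toℚ (a ℤ.+ b) ≡ toℚ a + toℚ b
  toℚ-+ a b = toℚᵘ-injective (ℚᵘ.≃-trans (toℚᵘ-toℚ (a ℤ.+ b)) (ℚᵘ.≃-trans integral-+
    (ℚᵘ.≃-sym (ℚᵘ.≃-trans (toℚᵘ-homo-+ (toℚ a) (toℚ b)) (ℚᵘ.+-cong (toℚᵘ-toℚ a) (toℚᵘ-toℚ b))))))
    where
    integral-+ : integral (a ℤ.+ b) ℚᵘ.≃ (integral a ℚᵘ.+ integral b)
    integral-+ = ℚᵘ.*≡* (solve 2 (λ a b → (a :+ b) :* con (+ 1) := (a :* con (+ 1) :+ b :* con (+ 1)) :* con (+ 1)) refl a b)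

  toℚ-* : ∀ a b → toℚ (a ℤ.* b) ≡ toℚ a * toℚ b
  toℚ-* a b = toℚᵘ-injective (ℚᵘ.≃-trans (toℚᵘ-toℚ (a ℤ.* b)) (ℚᵘ.≃-trans integral-*
    (ℚᵘ.≃-sym (ℚᵘ.≃-trans (toℚᵘ-homo-* (toℚ a) (toℚ b)) (ℚᵘ.*-cong (toℚᵘ-toℚ a) (toℚᵘ-toℚ b))))))
    where
    integral-* : integral (a ℤ.* b) ℚᵘ.≃ (integral a ℚᵘ.* integral b)
    integral-* = ℚᵘ.*≡* (solve 2 (λ a b → (a :* b) :* con (+ 1) := (a :* b) :* con (+ 1)) refl a b)

  toℚ-neg : ∀ a → toℚ (ℤ.- a) ≡ - toℚ a
  toℚ-neg a = toℚᵘ-injective (ℚᵘ.≃-trans (toℚᵘ-toℚ (ℤ.- a))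
    (ℚᵘ.≃-sym (ℚᵘ.≃-trans (toℚᵘ-homo‿- (toℚ a)) (ℚᵘ.-‿cong (toℚᵘ-toℚ a)))))

  sumℚ-cong : ∀ n {f g : ℕ → ℚ} → (∀ l → f l ≡ g l) → sumℚ n f ≡ sumℚ n g
  sumℚ-cong zero    f≡g = f≡g 0
  sumℚ-cong (suc n) f≡g = cong₂ _+_ (sumℚ-cong n f≡g) (f≡g (suc n))

  sumℚ-toℚ : ∀ n (g : ℕ → ℤ) → sumℚ n (λ l → toℚ (g l)) ≡ toℚ (sumℤ n g)
  sumℚ-toℚ zero    g = refl
  sumℚ-toℚ (suc n) g = trans (cong (_+ toℚ (g (suc n))) (sumℚ-toℚ n g)) (sym (toℚ-+ (sumℤ n g) (g (suc n))))

  sgn≡toℚ-sgnℤ : ∀ j → sgn j ≡ toℚ (sgnℤ j)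
  sgn≡toℚ-sgnℤ zero    = refl
  sgn≡toℚ-sgnℤ (suc j) = trans (cong -_ (sgn≡toℚ-sgnℤ j)) (sym (toℚ-neg (sgnℤ j)))

  δ0ℤ : ℕ → ℤ
  δ0ℤ zero    = ℤ.1ℤ
  δ0ℤ (suc _) = ℤ.0ℤ

  δ0≡toℚ-δ0ℤ : ∀ l → δ0 l ≡ toℚ (δ0ℤ l)
  δ0≡toℚ-δ0ℤ zero    = refl
  δ0≡toℚ-δ0ℤ (suc l) = refl

  1/[1+k]*[1+k]≡1 : ∀ k → (+ 1 / suc k) * toℚ (+ suc k) ≡ 1ℚ
  1/[1+k]*[1+k]≡1 k = toℚᵘ-injective (ℚᵘ.≃-trans (toℚᵘ-homo-* (+ 1 / suc k) (toℚ (+ suc k)))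
    (ℚᵘ.≃-trans (ℚᵘ.*-cong (toℚᵘ-fromℚᵘ (ℚᵘ.mkℚᵘ (+ 1) k)) (toℚᵘ-toℚ (+ suc k))) cancel))
    where
    cancel : (ℚᵘ.mkℚᵘ (+ 1) k ℚᵘ.* integral (+ suc k)) ℚᵘ.≃ ℚ.toℚᵘ 1ℚ
    cancel = ℚᵘ.*≡* (trans (ℤ.*-identityʳ _) (trans (ℤ.*-identityˡ (+ suc k))
                      (cong +_ (trans (sym (ℕ.*-identityʳ (suc k))) (sym (ℕ.*-identityˡ (suc k ℕ.* 1)))))))

module ColouredSchroder (k : ℕ) where

  open import Data.Nat as ℕ using (suc)
  open import Data.Integer as ℤ using (ℤ; +_; 1ℤ; -_; _^_)
  open import Relation.Binary.PropositionalEquality using (_≗_; refl)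
  open PowerSeries

  q r : ℕ
  q = suc k
  r = suc (suc k)

  q² : ℤ
  q² = (+ q) ^ 2

  A W : Series
  A = SchroderSeries.schroderSeries 1ℤ (+ q)
  W = SchroderSeries.schroderSeries 1ℤ (- q²)

  A-quadratic : A ≗ 𝟙 ⊕ κ 1ℤ ⊛ X ⊛ A ⊕ κ (+ q) ⊛ X ⊛ A ⊛ A
  A-quadratic = SchroderSeries.schroderSeries-quadratic 1ℤ (+ q)

  W-quadratic : W ≗ 𝟙 ⊕ κ 1ℤ ⊛ X ⊛ W ⊕ κ (- q²) ⊛ X ⊛ W ⊛ W
  W-quadratic = SchroderSeries.schroderSeries-quadratic 1ℤ (- q²)

  module Even = Substitution (X ⊛ X) refl

  Â Ŵ : Series
  Â = Even.compose A
  Ŵ = Even.compose W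

  Â-quadratic : Â ≗ 𝟙 ⊕ κ 1ℤ ⊛ (X ⊛ X) ⊛ Â ⊕ κ (+ q) ⊛ (X ⊛ X) ⊛ Â ⊛ Â
  Â-quadratic = Even.compose-quadratic 1ℤ (+ q) A A-quadratic

  Ŵ-quadratic : Ŵ ≗ 𝟙 ⊕ κ 1ℤ ⊛ (X ⊛ X) ⊛ Ŵ ⊕ κ (- q²) ⊛ (X ⊛ X) ⊛ Ŵ ⊛ Ŵ
  Ŵ-quadratic = Even.compose-quadratic 1ℤ (- q²) W W-quadratic

module UpStepSeries (k : ℕ) where

  open import Data.Bool using (Bool; true; false)
  open import Data.Nat as ℕ using (zero; suc)
  import Data.Nat.Properties as ℕ
  open import Data.Integer as ℤ using (+_; 0ℤ; 1ℤ; _+_; _*_)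
  open import Data.Integer.Properties using (pos-+; pos-*)
  open import Data.Product using (_×_; _,_; proj₁; proj₂)
  open import Relation.Binary.PropositionalEquality
  open import Function using (_∘_)
  open import Defs using (U)
  open PowerSeries
  open PathCounting using (suffixes; colourChoices; U≡upSteps)
  open FirstPassage using (prefixesU; prefixesD; prefixes; convolveℕ; upSteps-convolution)
  open ColouredSchroder k

  -- One level of descent: an excursion (Â) followed by a d-step in one of the r − 1 colours differing from the last one.
  F : Series
  F = X ⊛ κ (+ q) ⊛ Â

  suffixSeries : Bool → ℕ → Series
  suffixSeries true  zero    = Â
  suffixSeries true  (suc h) = X ⊛ (𝟙 ⊕ κ (+ q) ⊛ Â) ⊛ pow F h ⊛ Â
  suffixSeries false h       = pow F h ⊛ Â

  private
    Â-defect≗𝟘 : Â ⊕ ⊖ (𝟙 ⊕ κ 1ℤ ⊛ (X ⊛ X) ⊛ Â ⊕ κ (+ q) ⊛ (X ⊛ X) ⊛ Â ⊛ Â) ≗ 𝟘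
    Â-defect≗𝟘 = difference-≗𝟘 Â-quadratic

  Â-step : Â ≗ κ 1ℤ ⊕ X ⊛ suffixSeries true 1
  Â-step = ≗-by-difference (rearrange Â X (κ (+ q))) Â-defect≗𝟘
    where
    open SeriesSolver
    rearrange : ∀ a x Q → a ⊕ ⊖ (κ 1ℤ ⊕ x ⊛ (x ⊛ (𝟙 ⊕ Q ⊛ a) ⊛ 𝟙 ⊛ a)) ≗ a ⊕ ⊖ (𝟙 ⊕ κ 1ℤ ⊛ (x ⊛ x) ⊛ a ⊕ Q ⊛ (x ⊛ x) ⊛ a ⊛ a)
    rearrange = solve 3 (λ a x Q → a :- (con 1ℤ :+ x :* (x :* (con 1ℤ :+ Q :* a) :* con 1ℤ :* a))
                                 := a :- (con 1ℤ :+ con 1ℤ :* (x :* x) :* a :+ Q :* (x :* x) :* a :* a)) ≗-refl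

  suffixSeries-step₀ : ∀ b → suffixSeries b 0 ≗ κ 1ℤ ⊕ X ⊛ suffixSeries true 1
  suffixSeries-step₀ true  = Â-step
  suffixSeries-step₀ false = ≗-trans (⊛-identityˡ Â) Â-step

  suffixSeries-step : ∀ b h → suffixSeries b (suc h) ≗
                      κ 0ℤ ⊕ X ⊛ (suffixSeries true (suc (suc h)) ⊕ κ (+ colourChoices r b) ⊛ suffixSeries false h)
  suffixSeries-step true  h = ≗-trans (≗-by-difference (rearrange Â X (κ (+ q)) (pow F h)) (⊛-≗𝟘 (X ⊛ pow F h ⊛ Â ⊛ κ (+ q)) Â-defect≗𝟘))
    (⊕-cong (≗-refl {κ 0ℤ}) (⊛-cong (≗-refl {X}) (⊕-cong (≗-refl {suffixSeries true (suc (suc h))}) (⊛-cong (≗-sym (κ-+ 1ℤ (+ q))) ≗-refl))))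
    where
    open SeriesSolver
    rearrange : ∀ a x Q P → x ⊛ (𝟙 ⊕ Q ⊛ a) ⊛ P ⊛ a ⊕ ⊖ (κ 0ℤ ⊕ x ⊛ (x ⊛ (𝟙 ⊕ Q ⊛ a) ⊛ ((x ⊛ Q ⊛ a) ⊛ P) ⊛ a ⊕ (κ 1ℤ ⊕ Q) ⊛ (P ⊛ a)))
                        ≗ x ⊛ P ⊛ a ⊛ Q ⊛ (a ⊕ ⊖ (𝟙 ⊕ κ 1ℤ ⊛ (x ⊛ x) ⊛ a ⊕ Q ⊛ (x ⊛ x) ⊛ a ⊛ a))
    rearrange = solve 4 (λ a x Q P → x :* (con 1ℤ :+ Q :* a) :* P :* a :- (con 0ℤ :+ x :* (x :* (con 1ℤ :+ Q :* a) :* ((x :* Q :* a) :* P) :* a :+ (con 1ℤ :+ Q) :* (P :* a)))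
                                   := x :* P :* a :* Q :* (a :- (con 1ℤ :+ con 1ℤ :* (x :* x) :* a :+ Q :* (x :* x) :* a :* a))) ≗-refl
  suffixSeries-step false h = ≗-by-difference (rearrange Â X (κ (+ q)) (pow F h)) (⊛-≗𝟘 (X ⊛ pow F h ⊛ Â ⊛ κ (+ q)) Â-defect≗𝟘)
    where
    open SeriesSolver
    rearrange : ∀ a x Q P → ((x ⊛ Q ⊛ a) ⊛ P) ⊛ a ⊕ ⊖ (κ 0ℤ ⊕ x ⊛ (x ⊛ (𝟙 ⊕ Q ⊛ a) ⊛ ((x ⊛ Q ⊛ a) ⊛ P) ⊛ a ⊕ Q ⊛ (P ⊛ a)))
                        ≗ x ⊛ P ⊛ a ⊛ Q ⊛ (a ⊕ ⊖ (𝟙 ⊕ κ 1ℤ ⊛ (x ⊛ x) ⊛ a ⊕ Q ⊛ (x ⊛ x) ⊛ a ⊛ a))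
    rearrange = solve 4 (λ a x Q P → ((x :* Q :* a) :* P) :* a :- (con 0ℤ :+ x :* (x :* (con 1ℤ :+ Q :* a) :* ((x :* Q :* a) :* P) :* a :+ Q :* (P :* a)))
                                   := x :* P :* a :* Q :* (a :- (con 1ℤ :+ con 1ℤ :* (x :* x) :* a :+ Q :* (x :* x) :* a :* a))) ≗-refl

  suffixes-coefficient : ∀ m b h → + suffixes r b h m ≡ suffixSeries b h m
  suffixes-coefficient zero    b zero    = sym (head-κ⊕X⊛ (suffixSeries-step₀ b))
  suffixes-coefficient zero    b (suc h) = sym (head-κ⊕X⊛ (suffixSeries-step b h))
  suffixes-coefficient (suc m) b zero    = trans (suffixes-coefficient m true 1) (sym (tail-κ⊕X⊛ (suffixSeries-step₀ b) m))
  suffixes-coefficient (suc m) b (suc h) = trans step (sym (tail-κ⊕X⊛ (suffixSeries-step b h) m))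
    where
    c : ℕ
    c = colourChoices r b
    step : + (suffixes r true (suc (suc h)) m ℕ.+ c ℕ.* suffixes r false h m)
           ≡ (suffixSeries true (suc (suc h)) ⊕ κ (+ c) ⊛ suffixSeries false h) m
    step = trans (pos-+ _ (c ℕ.* suffixes r false h m)) (cong₂ _+_ (suffixes-coefficient m true (suc (suc h)))
             (trans (pos-* c _) (trans (cong (+ c *_) (suffixes-coefficient m false h)) (sym (κ-⊛ (+ c) (suffixSeries false h) m)))))

  G : Series
  G = X ⊛ Â

  prefixSeriesU prefixSeriesD : ℕ → Series
  prefixSeriesU j = pow G j
  prefixSeriesD j = pow G j ⊛ (Â ⊕ ⊖ 𝟙)

  prefixSeriesU-step : ∀ j → prefixSeriesU (suc j) ≗ κ 0ℤ ⊕ X ⊛ (prefixSeriesU j ⊕ prefixSeriesD j)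
  prefixSeriesU-step j = rearrange X Â (pow G j)
    where
    open SeriesSolver
    rearrange : ∀ x a P → (x ⊛ a) ⊛ P ≗ κ 0ℤ ⊕ x ⊛ (P ⊕ P ⊛ (a ⊕ ⊖ 𝟙))
    rearrange = solve 3 (λ x a P → (x :* a) :* P := con 0ℤ :+ x :* (P :+ P :* (a :- con 1ℤ))) ≗-refl

  prefixSeriesD-step : ∀ j → prefixSeriesD j ≗ κ 0ℤ ⊕ X ⊛ (κ (+ r) ⊛ prefixSeriesU (suc j) ⊕ κ (+ q) ⊛ prefixSeriesD (suc j))
  prefixSeriesD-step j = ≗-trans (≗-by-difference (rearrange Â X (κ (+ q)) (pow G j)) (⊛-≗𝟘 (pow G j) Â-defect≗𝟘))
    (⊕-cong (≗-refl {κ 0ℤ}) (⊛-cong (≗-refl {X}) (⊕-cong (⊛-cong (≗-sym (κ-+ 1ℤ (+ q))) (≗-refl {prefixSeriesU (suc j)})) ≗-refl)))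
    where
    open SeriesSolver
    rearrange : ∀ a x Q P → P ⊛ (a ⊕ ⊖ 𝟙) ⊕ ⊖ (κ 0ℤ ⊕ x ⊛ ((κ 1ℤ ⊕ Q) ⊛ ((x ⊛ a) ⊛ P) ⊕ Q ⊛ (((x ⊛ a) ⊛ P) ⊛ (a ⊕ ⊖ 𝟙))))
                        ≗ P ⊛ (a ⊕ ⊖ (𝟙 ⊕ κ 1ℤ ⊛ (x ⊛ x) ⊛ a ⊕ Q ⊛ (x ⊛ x) ⊛ a ⊛ a))
    rearrange = solve 4 (λ a x Q P → P :* (a :- con 1ℤ) :- (con 0ℤ :+ x :* ((con 1ℤ :+ Q) :* ((x :* a) :* P) :+ Q :* (((x :* a) :* P) :* (a :- con 1ℤ))))
                                   := P :* (a :- (con 1ℤ :+ con 1ℤ :* (x :* x) :* a :+ Q :* (x :* x) :* a :* a))) ≗-refl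

  prefixes-coefficients : ∀ i j → (+ prefixesU r j i ≡ prefixSeriesU j i) × (+ prefixesD r j i ≡ prefixSeriesD j i)
  prefixes-coefficients zero    zero    = refl , sym (head-κ⊕X⊛ (prefixSeriesD-step 0))
  prefixes-coefficients zero    (suc j) = sym (head-κ⊕X⊛ (prefixSeriesU-step j)) , sym (head-κ⊕X⊛ (prefixSeriesD-step (suc j)))
  prefixes-coefficients (suc i) j       = U-coefficient j , D-coefficient
    where
    U-coefficient : ∀ j → + prefixesU r j (suc i) ≡ prefixSeriesU j (suc i)
    U-coefficient zero    = refl
    U-coefficient (suc j) = trans (pos-+ (prefixesU r j i) (prefixesD r j i))
      (trans (cong₂ _+_ (proj₁ (prefixes-coefficients i j)) (proj₂ (prefixes-coefficients i j))) (sym (tail-κ⊕X⊛ (prefixSeriesU-step j) i)))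
    D-coefficient : + prefixesD r j (suc i) ≡ prefixSeriesD j (suc i)
    D-coefficient = begin
      + (r ℕ.* prefixesU r (suc j) i ℕ.+ q ℕ.* prefixesD r (suc j) i)
        ≡⟨ trans (pos-+ (r ℕ.* prefixesU r (suc j) i) _) (cong₂ _+_ (pos-* r (prefixesU r (suc j) i)) (pos-* q (prefixesD r (suc j) i))) ⟩
      + r * + prefixesU r (suc j) i + + q * + prefixesD r (suc j) i
        ≡⟨ cong₂ (λ u v → + r * u + + q * v) (proj₁ (prefixes-coefficients i (suc j))) (proj₂ (prefixes-coefficients i (suc j))) ⟩
      + r * prefixSeriesU (suc j) i + + q * prefixSeriesD (suc j) i
        ≡⟨ cong₂ _+_ (κ-⊛ (+ r) (prefixSeriesU (suc j)) i) (κ-⊛ (+ q) (prefixSeriesD (suc j)) i) ⟨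
      (κ (+ r) ⊛ prefixSeriesU (suc j) ⊕ κ (+ q) ⊛ prefixSeriesD (suc j)) i
        ≡⟨ tail-κ⊕X⊛ (prefixSeriesD-step j) i ⟨
      prefixSeriesD j (suc i) ∎
      where open ≡-Reasoning

  prefixes-coefficient : ∀ ℓ i → + prefixes r ℓ i ≡ (pow G ℓ ⊛ Â) i
  prefixes-coefficient ℓ i = trans (pos-+ (prefixesU r ℓ i) (prefixesD r ℓ i))
    (trans (cong₂ _+_ (proj₁ (prefixes-coefficients i ℓ)) (proj₂ (prefixes-coefficients i ℓ))) (collect (pow G ℓ) Â i))
    where
    open SeriesSolver
    collect : ∀ P a → P ⊕ P ⊛ (a ⊕ ⊖ 𝟙) ≗ P ⊛ a
    collect = solve 2 (λ P a → P :+ P :* (a :- con 1ℤ) := P :* a) ≗-refl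

  convolveℕ-⊛ : ∀ P B m → + convolveℕ P B (suc m) ≡ ((+_ ∘ P) ⊛ (+_ ∘ B)) m
  convolveℕ-⊛ P B zero    = trans (cong +_ (ℕ.+-identityʳ (P 0 ℕ.* B 0))) (pos-* (P 0) (B 0))
  convolveℕ-⊛ P B (suc m) = trans (pos-+ (P 0 ℕ.* B (suc m)) (convolveℕ (P ∘ suc) B (suc m)))
                                  (cong₂ _+_ (pos-* (P 0) (B (suc m))) (convolveℕ-⊛ (P ∘ suc) B m))

  upStepWeight : Series
  upStepWeight = Â ⊛ Â ⊛ (𝟙 ⊕ κ (+ q) ⊛ Â)

  levelStep : Series
  levelStep = κ (+ q) ⊛ X ⊛ X ⊛ Â ⊛ Â

  U-series : ∀ ℓ → (pow G ℓ ⊛ Â) ⊛ suffixSeries true (suc ℓ) ≗ X ⊛ (upStepWeight ⊛ pow levelStep ℓ)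
  U-series ℓ = ≗-trans (regroup X Â (κ (+ q)) (pow G ℓ) (pow F ℓ))
    (⊛-cong (≗-refl {X}) (⊛-cong (≗-refl {upStepWeight}) (≗-trans (≗-sym (pow-⊛ G F ℓ)) (pow-cong (merge X Â (κ (+ q))) ℓ))))
    where
    open SeriesSolver
    regroup : ∀ x a Q PG PF → (PG ⊛ a) ⊛ (x ⊛ (𝟙 ⊕ Q ⊛ a) ⊛ PF ⊛ a) ≗ x ⊛ (a ⊛ a ⊛ (𝟙 ⊕ Q ⊛ a) ⊛ (PG ⊛ PF))
    regroup = solve 5 (λ x a Q PG PF → (PG :* a) :* (x :* (con 1ℤ :+ Q :* a) :* PF :* a) := x :* (a :* a :* (con 1ℤ :+ Q :* a) :* (PG :* PF))) ≗-refl
    merge : ∀ x a Q → (x ⊛ a) ⊛ (x ⊛ Q ⊛ a) ≗ Q ⊛ x ⊛ x ⊛ a ⊛ a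
    merge = solve 3 (λ x a Q → (x :* a) :* (x :* Q :* a) := Q :* x :* x :* a :* a) ≗-refl

  U-coefficient : ∀ n ℓ → + U r n ℓ ≡ (upStepWeight ⊛ pow levelStep ℓ) (2 ℕ.* n)
  U-coefficient n ℓ = begin
    + U r n ℓ
      ≡⟨ cong +_ (trans (U≡upSteps r n ℓ) (upSteps-convolution r ℓ (2 ℕ.* suc n))) ⟩
    + convolveℕ (prefixes r ℓ) (suffixes r true (suc ℓ)) (2 ℕ.* suc n)
      ≡⟨ cong (+_ ∘ convolveℕ (prefixes r ℓ) (suffixes r true (suc ℓ))) (ℕ.*-suc 2 n) ⟩
    + convolveℕ (prefixes r ℓ) (suffixes r true (suc ℓ)) (suc (suc (2 ℕ.* n)))
      ≡⟨ convolveℕ-⊛ (prefixes r ℓ) (suffixes r true (suc ℓ)) (suc (2 ℕ.* n)) ⟩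
    ((+_ ∘ prefixes r ℓ) ⊛ (+_ ∘ suffixes r true (suc ℓ))) (suc (2 ℕ.* n))
      ≡⟨ ⊛-cong (prefixes-coefficient ℓ) (λ j → suffixes-coefficient j true (suc ℓ)) (suc (2 ℕ.* n)) ⟩
    ((pow G ℓ ⊛ Â) ⊛ suffixSeries true (suc ℓ)) (suc (2 ℕ.* n))
      ≡⟨ U-series ℓ (suc (2 ℕ.* n)) ⟩
    (X ⊛ (upStepWeight ⊛ pow levelStep ℓ)) (suc (2 ℕ.* n))
      ≡⟨ X⊛-suc (upStepWeight ⊛ pow levelStep ℓ) (2 ℕ.* n) ⟩
    (upStepWeight ⊛ pow levelStep ℓ) (2 ℕ.* n) ∎
    where open ≡-Reasoning

module AlternatingSum (k : ℕ) where

  open import Data.Nat as ℕ using (zero; suc; _≤_; _<_; z≤n; s≤s)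
  import Data.Nat.Properties as ℕ
  open import Data.Integer as ℤ using (+_; 0ℤ; 1ℤ; _+_; _*_; -_)
  open import Data.Integer.Solver using (module +-*-Solver)
  open import Relation.Binary.PropositionalEquality
  open import Defs using (U; sumℤ)
  open IntegerSums
  open PowerSeries
  open Signs using (sgnℤ)
  open ColouredSchroder k
  open UpStepSeries k using (upStepWeight; levelStep; U-coefficient)

  levelStep≗X²⊛ : levelStep ≗ X ⊛ X ⊛ (κ (+ q) ⊛ Â ⊛ Â)
  levelStep≗X²⊛ = regroup X Â (κ (+ q))
    where
    open SeriesSolver
    regroup : ∀ x a Q → Q ⊛ x ⊛ x ⊛ a ⊛ a ≗ x ⊛ x ⊛ (Q ⊛ a ⊛ a)
    regroup = solve 3 (λ x a Q → Q :* x :* x :* a :* a := x :* x :* (Q :* a :* a)) ≗-refl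

  -- The alternating sign (−1)^ℓ is absorbed by substituting −levelStep.
  negStep : Series
  negStep = ⊖ levelStep

  negStep-vanishes : ∀ i → i < 2 → negStep i ≡ 0ℤ
  negStep-vanishes zero       _ = cong -_ (levelStep≗X²⊛ 0)
  negStep-vanishes (suc zero) _ = cong -_ (trans (levelStep≗X²⊛ 1) (X²⊛-one (κ (+ q) ⊛ Â ⊛ Â)))
  negStep-vanishes (suc (suc i)) (s≤s (s≤s ()))

  module Neg = Substitution negStep (negStep-vanishes 0 (s≤s z≤n))

  pow-negStep : ∀ ℓ → pow negStep ℓ ≗ κ (sgnℤ ℓ) ⊛ pow levelStep ℓ
  pow-negStep zero    = ≗-sym (⊛-identityˡ 𝟙)
  pow-negStep (suc ℓ) = ≗-trans (⊛-cong (≗-refl {negStep}) (pow-negStep ℓ))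
    (≗-trans (swap-sign levelStep (κ (sgnℤ ℓ)) (pow levelStep ℓ)) (⊛-cong (≗-sym (κ-neg (sgnℤ ℓ))) ≗-refl))
    where
    open SeriesSolver
    swap-sign : ∀ F S P → ⊖ F ⊛ (S ⊛ P) ≗ ⊖ S ⊛ (F ⊛ P)
    swap-sign = solve 3 (λ F S P → (:- F) :* (S :* P) := (:- S) :* (F :* P)) ≗-refl

  composeUpTo≡compose-even : ∀ K n j → j ≤ 2 ℕ.* n → Neg.composeUpTo n K j ≡ Neg.compose K j
  composeUpTo≡compose-even K n j j≤2n =
    trans (sym (Neg.composeUpTo-stable n (n ℕ.+ j) K j (ℕ.m≤m+n n j) beyond)) (Neg.composeUpTo≡compose (n ℕ.+ j) K j (ℕ.m≤n+m j n))
    where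
    beyond : ∀ l → n < l → pow negStep l j ≡ 0ℤ
    beyond l n<l = pow-vanishes 2 negStep negStep-vanishes l j
      (ℕ.≤-<-trans j≤2n (subst (2 ℕ.* n <_) (ℕ.*-comm 2 l) (ℕ.*-monoʳ-< 2 n<l)))

  ΔA : Series
  ΔA = κ (+ q) ⊛ A ⊛ A

  A-difference : ∀ ℓ → A (ℓ ℕ.+ 1) ℤ.- A ℓ ≡ ΔA ℓ
  A-difference ℓ = begin
    A (ℓ ℕ.+ 1) + - A ℓ                       ≡⟨ cong (λ z → A z + - A ℓ) (ℕ.+-comm ℓ 1) ⟩
    A (suc ℓ) + - A ℓ                         ≡⟨ cong (_+ - A ℓ) (quadratic-suc 1ℤ (+ q) A-quadratic ℓ) ⟩
    1ℤ * A ℓ + + q * (A ⊛ A) ℓ + - A ℓ        ≡⟨ cancel (A ℓ) (+ q) ((A ⊛ A) ℓ) ⟩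
    + q * (A ⊛ A) ℓ                           ≡⟨ trans (⊛-assoc (κ (+ q)) A A ℓ) (κ-⊛ (+ q) (A ⊛ A) ℓ) ⟨
    ΔA ℓ                                      ∎
    where
    open ≡-Reasoning
    open +-*-Solver
    cancel : ∀ a q c → 1ℤ * a + q * c + - a ≡ q * c
    cancel = solve 3 (λ a q c → con 1ℤ :* a :+ q :* c :- a := q :* c) refl

  A∘negStep : Series
  A∘negStep = Neg.compose A

  A∘negStep-quadratic : A∘negStep ≗ 𝟙 ⊕ κ 1ℤ ⊛ negStep ⊛ A∘negStep ⊕ κ (+ q) ⊛ negStep ⊛ A∘negStep ⊛ A∘negStep
  A∘negStep-quadratic = Neg.compose-quadratic 1ℤ (+ q) A A-quadratic

  tailTerms : Series → Series
  tailTerms Y = κ (+ q) ⊛ Â ⊛ Â ⊛ Y ⊕ κ (+ q) ⊛ κ (+ q) ⊛ Â ⊛ Y ⊛ Y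

  tailTerms-causal : Causal (λ Y → ⊖ (X ⊛ tailTerms Y))
  tailTerms-causal j {Y₁} {Y₂} Y₁≡Y₂ =
    cong -_ (⊛-cong-upTo j (λ _ _ → refl) (λ s s≤j → tailTerms-upTo s (λ t t≤s → Y₁≡Y₂ t (ℕ.≤-trans t≤s s≤j))))
    where
    tailTerms-upTo : ∀ s → (∀ t → t ≤ s → Y₁ t ≡ Y₂ t) → tailTerms Y₁ s ≡ tailTerms Y₂ s
    tailTerms-upTo s agree = cong₂ _+_ (⊛-cong-upTo s (λ _ _ → refl) agree)
      (⊛-cong-upTo s (λ t t≤s → ⊛-cong-upTo t (λ _ _ → refl) (λ u u≤t → agree u (ℕ.≤-trans u≤t t≤s))) agree)

  Â⊛A∘negStep-equation : Â ⊛ A∘negStep ≗ Â ⊕ X ⊛ ⊖ (X ⊛ tailTerms (Â ⊛ A∘negStep))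
  Â⊛A∘negStep-equation = ≗-by-difference (rearrange Â A∘negStep X (κ (+ q))) (⊛-≗𝟘 Â (difference-≗𝟘 A∘negStep-quadratic))
    where
    open SeriesSolver
    rearrange : ∀ a b x Q → a ⊛ b ⊕ ⊖ (a ⊕ x ⊛ ⊖ (x ⊛ (Q ⊛ a ⊛ a ⊛ (a ⊛ b) ⊕ Q ⊛ Q ⊛ a ⊛ (a ⊛ b) ⊛ (a ⊛ b))))
                      ≗ a ⊛ (b ⊕ ⊖ (𝟙 ⊕ κ 1ℤ ⊛ ⊖ (Q ⊛ x ⊛ x ⊛ a ⊛ a) ⊛ b ⊕ Q ⊛ ⊖ (Q ⊛ x ⊛ x ⊛ a ⊛ a) ⊛ b ⊛ b))
    rearrange = solve 4 (λ a b x Q → a :* b :- (a :+ x :* (:- (x :* (Q :* a :* a :* (a :* b) :+ Q :* Q :* a :* (a :* b) :* (a :* b)))))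
                                   := a :* (b :- (con 1ℤ :+ con 1ℤ :* (:- (Q :* x :* x :* a :* a)) :* b :+ Q :* (:- (Q :* x :* x :* a :* a)) :* b :* b))) ≗-refl

  Ŵ-equation : Ŵ ≗ Â ⊕ X ⊛ ⊖ (X ⊛ tailTerms Ŵ)
  Ŵ-equation = ≗-by-difference (rearrange Â Ŵ X (κ (+ q)))
    (λ n → cong₂ _+_ (⊛-≗𝟘 Â (difference-≗𝟘 Ŵ-quadratic′) n) (cong -_ (⊛-≗𝟘 Ŵ (difference-≗𝟘 Â-quadratic) n)))
    where
    open SeriesSolver
    Ŵ-quadratic′ : Ŵ ≗ 𝟙 ⊕ κ 1ℤ ⊛ (X ⊛ X) ⊛ Ŵ ⊕ ⊖ (κ (+ q) ⊛ κ (+ q)) ⊛ (X ⊛ X) ⊛ Ŵ ⊛ Ŵ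
    Ŵ-quadratic′ = ≗-trans Ŵ-quadratic (⊕-cong (≗-refl {𝟙 ⊕ κ 1ℤ ⊛ (X ⊛ X) ⊛ Ŵ}) (⊛-cong (⊛-cong (⊛-cong κ-neg-q² ≗-refl) ≗-refl) ≗-refl))
      where
      κ-neg-q² : κ (- q²) ≗ ⊖ (κ (+ q) ⊛ κ (+ q))
      κ-neg-q² = ≗-trans (κ-neg q²) (⊖-cong (≗-trans (λ n → cong (λ z → κ z n) (cong (+ q *_) (ℤ.*-identityʳ (+ q)))) (κ-* (+ q) (+ q))))
        where import Data.Integer.Properties as ℤ
    rearrange : ∀ a w x Q → w ⊕ ⊖ (a ⊕ x ⊛ ⊖ (x ⊛ (Q ⊛ a ⊛ a ⊛ w ⊕ Q ⊛ Q ⊛ a ⊛ w ⊛ w)))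
                      ≗ a ⊛ (w ⊕ ⊖ (𝟙 ⊕ κ 1ℤ ⊛ (x ⊛ x) ⊛ w ⊕ ⊖ (Q ⊛ Q) ⊛ (x ⊛ x) ⊛ w ⊛ w))
                        ⊕ ⊖ (w ⊛ (a ⊕ ⊖ (𝟙 ⊕ κ 1ℤ ⊛ (x ⊛ x) ⊛ a ⊕ Q ⊛ (x ⊛ x) ⊛ a ⊛ a)))
    rearrange = solve 4 (λ a w x Q → w :- (a :+ x :* (:- (x :* (Q :* a :* a :* w :+ Q :* Q :* a :* w :* w))))
      := a :* (w :- (con 1ℤ :+ con 1ℤ :* (x :* x) :* w :+ (:- (Q :* Q)) :* (x :* x) :* w :* w))
         :- (w :* (a :- (con 1ℤ :+ con 1ℤ :* (x :* x) :* a :+ Q :* (x :* x) :* a :* a)))) ≗-refl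

  -- Both solve Y = Â − X² · tailTerms Y, whose solution is unique.
  Â⊛A∘negStep≗Ŵ : Â ⊛ A∘negStep ≗ Ŵ
  Â⊛A∘negStep≗Ŵ = fixed-point-unique (λ Y → ⊖ (X ⊛ tailTerms Y)) Â tailTerms-causal Â⊛A∘negStep-equation Ŵ-equation

  -- Both sides of the corollary are coefficients of this series.
  target : Series
  target = κ (+ q) ⊛ (𝟙 ⊕ κ (+ q) ⊛ A) ⊛ W ⊛ W

  compose-ΔA : Neg.compose ΔA ≗ κ (+ q) ⊛ A∘negStep ⊛ A∘negStep
  compose-ΔA = ≗-trans (Neg.compose-⊛ (κ (+ q) ⊛ A) A)
    (⊛-cong (≗-trans (Neg.compose-⊛ (κ (+ q)) A) (⊛-cong (Neg.compose-κ (+ q)) (≗-refl {A∘negStep}))) (≗-refl {A∘negStep}))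

  even-compose-target : Even.compose target ≗ κ (+ q) ⊛ (𝟙 ⊕ κ (+ q) ⊛ Â) ⊛ Ŵ ⊛ Ŵ
  even-compose-target =
    ≗-trans (Even.compose-⊛ (κ (+ q) ⊛ (𝟙 ⊕ κ (+ q) ⊛ A) ⊛ W) W) (⊛-cong (≗-trans (Even.compose-⊛ (κ (+ q) ⊛ (𝟙 ⊕ κ (+ q) ⊛ A)) W)
      (⊛-cong (≗-trans (Even.compose-⊛ (κ (+ q)) (𝟙 ⊕ κ (+ q) ⊛ A)) (⊛-cong (Even.compose-κ (+ q))
        (≗-trans (Even.compose-⊕ 𝟙 (κ (+ q) ⊛ A)) (⊕-cong (Even.compose-κ 1ℤ)
          (≗-trans (Even.compose-⊛ (κ (+ q)) A) (⊛-cong (Even.compose-κ (+ q)) (≗-refl {Â})))))))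
      (≗-refl {Ŵ}))) (≗-refl {Ŵ}))

  generating-identity : upStepWeight ⊛ Neg.compose ΔA ≗ Even.compose target
  generating-identity = begin
    upStepWeight ⊛ Neg.compose ΔA                           ≈⟨ ⊛-cong (≗-refl {upStepWeight}) compose-ΔA ⟩
    Â ⊛ Â ⊛ (𝟙 ⊕ κ (+ q) ⊛ Â) ⊛ (κ (+ q) ⊛ A∘negStep ⊛ A∘negStep)       ≈⟨ regroup Â A∘negStep (κ (+ q)) ⟩
    κ (+ q) ⊛ (𝟙 ⊕ κ (+ q) ⊛ Â) ⊛ (Â ⊛ A∘negStep) ⊛ (Â ⊛ A∘negStep)
      ≈⟨ ⊛-cong (⊛-cong (≗-refl {κ (+ q) ⊛ (𝟙 ⊕ κ (+ q) ⊛ Â)}) Â⊛A∘negStep≗Ŵ) Â⊛A∘negStep≗Ŵ ⟩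
    κ (+ q) ⊛ (𝟙 ⊕ κ (+ q) ⊛ Â) ⊛ Ŵ ⊛ Ŵ                    ≈⟨ ≗-sym even-compose-target ⟩
    Even.compose target                                     ∎
    where
    open ≗-Reasoning
    open SeriesSolver
    regroup : ∀ a b Q → a ⊛ a ⊛ (𝟙 ⊕ Q ⊛ a) ⊛ (Q ⊛ b ⊛ b) ≗ Q ⊛ (𝟙 ⊕ Q ⊛ a) ⊛ (a ⊛ b) ⊛ (a ⊛ b)
    regroup = solve 3 (λ a b Q → a :* a :* (con 1ℤ :+ Q :* a) :* (Q :* b :* b) := Q :* (con 1ℤ :+ Q :* a) :* (a :* b) :* (a :* b)) ≗-refl

  alternating-sum≡target : ∀ n → sumℤ n (λ ℓ → sgnℤ ℓ * (+ U r n ℓ * (A (ℓ ℕ.+ 1) ℤ.- A ℓ))) ≡ target n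
  alternating-sum≡target n = begin
    sumℤ n (λ ℓ → sgnℤ ℓ * (+ U r n ℓ * (A (ℓ ℕ.+ 1) ℤ.- A ℓ)))        ≡⟨ sumℤ-cong n (λ ℓ _ → term ℓ) ⟩
    sumℤ n (λ ℓ → ΔA ℓ * (upStepWeight ⊛ pow negStep ℓ) (2 ℕ.* n)) ≡⟨ ⊛-sumℤ n ΔA (pow negStep) upStepWeight (2 ℕ.* n) ⟨
    (upStepWeight ⊛ Neg.composeUpTo n ΔA) (2 ℕ.* n)                   ≡⟨ ⊛-cong-upTo (2 ℕ.* n) (λ _ _ → refl) (composeUpTo≡compose-even ΔA n) ⟩
    (upStepWeight ⊛ Neg.compose ΔA) (2 ℕ.* n)                         ≡⟨ generating-identity (2 ℕ.* n) ⟩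
    Even.compose target (2 ℕ.* n)                                      ≡⟨ Even.compose-X²-even ≗-refl target n ⟩
    target n                                                          ∎
    where
    open ≡-Reasoning
    open +-*-Solver
    term : ∀ ℓ → sgnℤ ℓ * (+ U r n ℓ * (A (ℓ ℕ.+ 1) ℤ.- A ℓ)) ≡ ΔA ℓ * (upStepWeight ⊛ pow negStep ℓ) (2 ℕ.* n)
    term ℓ = begin
      sgnℤ ℓ * (+ U r n ℓ * (A (ℓ ℕ.+ 1) ℤ.- A ℓ))
        ≡⟨ cong₂ (λ u v → sgnℤ ℓ * (u * v)) (U-coefficient n ℓ) (A-difference ℓ) ⟩
      sgnℤ ℓ * ((upStepWeight ⊛ pow levelStep ℓ) (2 ℕ.* n) * ΔA ℓ)
        ≡⟨ solve 3 (λ s u c → s :* (u :* c) := c :* (s :* u)) refl (sgnℤ ℓ) _ (ΔA ℓ) ⟩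
      ΔA ℓ * (sgnℤ ℓ * (upStepWeight ⊛ pow levelStep ℓ) (2 ℕ.* n))
        ≡⟨ cong (ΔA ℓ *_) (trans (⊛-cong (≗-refl {upStepWeight}) (≗-trans (pow-negStep ℓ) (≗-sym (scale≗κ⊛ (sgnℤ ℓ) (pow levelStep ℓ)))) (2 ℕ.* n))
                                 (⊛-scale (sgnℤ ℓ) upStepWeight (pow levelStep ℓ) (2 ℕ.* n))) ⟨
      ΔA ℓ * (upStepWeight ⊛ pow negStep ℓ) (2 ℕ.* n)                ∎

module BothSides (k : ℕ) where

  open import Data.Nat as ℕ using (zero; suc; _∸_)
  import Data.Nat.Properties as ℕ
  open import Data.Integer as ℤ using (ℤ; +_; -[1+_]; 1ℤ; _+_; _*_; -_; _^_)
  open import Data.Integer.Properties using (*-identityˡ; *-identityʳ; *-distribˡ-+)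
  open import Data.Integer.Solver using (module +-*-Solver)
  import Data.Rational as ℚ
  open import Data.Rational.Solver renaming (module +-*-Solver to ℚ-Solver)
  import Data.Rational.Properties as ℚ
  open import Relation.Binary.PropositionalEquality
  open import Defs using (S; sumℤ; sumℚ; toℚ; sgn; δ0; δOverRm1; U; Sr)
  open IntegerSums
  open PowerSeries
  open Signs
  open IntegerToRational
  open ColouredSchroder k
  open AlternatingSum k using (target; alternating-sum≡target)

  lhs≡target : ∀ n → sumℚ n (λ ℓ → sgn ℓ ℚ.* (toℚ (+ U r n ℓ) ℚ.* toℚ (Sr r (ℓ ℕ.+ 1) ℤ.- Sr r ℓ))) ≡ toℚ (target n)
  lhs≡target n = trans (sumℚ-cong n term) (trans (sumℚ-toℚ n _) (cong toℚ (alternating-sum≡target n)))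
    where
    term : ∀ ℓ → sgn ℓ ℚ.* (toℚ (+ U r n ℓ) ℚ.* toℚ (Sr r (ℓ ℕ.+ 1) ℤ.- Sr r ℓ)) ≡ toℚ (sgnℤ ℓ * (+ U r n ℓ * (A (ℓ ℕ.+ 1) ℤ.- A ℓ)))
    term ℓ = trans (cong₂ ℚ._*_ (sgn≡toℚ-sgnℤ ℓ) (sym (toℚ-* (+ U r n ℓ) (A (ℓ ℕ.+ 1) ℤ.- A ℓ)))) (sym (toℚ-* (sgnℤ ℓ) _))

  T : ℕ → ℤ
  T j = S j -[1+ 0 ] q²

  alternating-pair : ∀ j → sgnℤ j * (T j + T (j ℕ.+ 1)) ≡ q² * (W ⊛ W) j
  alternating-pair j = begin
    sgnℤ j * (T j + T (j ℕ.+ 1))                                             ≡⟨ cong (λ z → sgnℤ j * (T j + T z)) (ℕ.+-comm j 1) ⟩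
    sgnℤ j * (T j + T (suc j))
      ≡⟨ cong₂ (λ u v → sgnℤ j * (u + v)) (S-at-−1 j q²) (trans (S-at-−1 (suc j) q²) (cong (- sgnℤ j *_) (quadratic-suc 1ℤ (- q²) W-quadratic j))) ⟩
    sgnℤ j * (sgnℤ j * W j + - sgnℤ j * (1ℤ * W j + - q² * (W ⊛ W) j))
      ≡⟨ solve 4 (λ s w b ww → s :* (s :* w :+ (:- s) :* (con 1ℤ :* w :+ (:- b) :* ww)) := s :* s :* (b :* ww)) refl (sgnℤ j) (W j) q² ((W ⊛ W) j) ⟩
    sgnℤ j * sgnℤ j * (q² * (W ⊛ W) j)                                       ≡⟨ cong (_* (q² * (W ⊛ W) j)) (sgnℤ*sgnℤ j) ⟩
    1ℤ * (q² * (W ⊛ W) j)                                                    ≡⟨ *-identityˡ _ ⟩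
    q² * (W ⊛ W) j                                                           ∎
    where
    open ≡-Reasoning
    open +-*-Solver

  signed-pair : ∀ j → sgn j ℚ.* toℚ (T j ℤ.+ T (j ℕ.+ 1)) ≡ toℚ (+ q) ℚ.* (toℚ (+ q) ℚ.* toℚ ((W ⊛ W) j))
  signed-pair j = begin
    sgn j ℚ.* toℚ (T j ℤ.+ T (j ℕ.+ 1))    ≡⟨ cong (ℚ._* toℚ (T j ℤ.+ T (j ℕ.+ 1))) (sgn≡toℚ-sgnℤ j) ⟩
    toℚ (sgnℤ j) ℚ.* toℚ (T j ℤ.+ T (j ℕ.+ 1)) ≡⟨ toℚ-* (sgnℤ j) (T j ℤ.+ T (j ℕ.+ 1)) ⟨
    toℚ (sgnℤ j * (T j ℤ.+ T (j ℕ.+ 1)))   ≡⟨ cong toℚ (alternating-pair j) ⟩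
    toℚ (q² * (W ⊛ W) j)                   ≡⟨ cong (λ z → toℚ (+ q * z * (W ⊛ W) j)) (*-identityʳ (+ q)) ⟩
    toℚ (+ q * + q * (W ⊛ W) j)            ≡⟨ trans (toℚ-* (+ q * + q) ((W ⊛ W) j)) (cong (ℚ._* toℚ ((W ⊛ W) j)) (toℚ-* (+ q) (+ q))) ⟩
    Q ℚ.* Q ℚ.* toℚ ((W ⊛ W) j)           ≡⟨ ℚ.*-assoc Q Q (toℚ ((W ⊛ W) j)) ⟩
    Q ℚ.* (Q ℚ.* toℚ ((W ⊛ W) j))         ∎
    where
    open ≡-Reasoning
    Q : ℚ.ℚ
    Q = toℚ (+ q)

  rhsTerm : ℕ → ℕ → ℤ
  rhsTerm n ℓ = (+ q * δ0ℤ ℓ + + q * (+ q * A ℓ)) * (W ⊛ W) (n ∸ ℓ)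

  target-as-sum : ∀ n → target n ≡ sumℤ n (rhsTerm n)
  target-as-sum n = begin
    target n                                                       ≡⟨ ⊛-assoc (κ (+ q) ⊛ (𝟙 ⊕ κ (+ q) ⊛ A)) W W n ⟩
    ((κ (+ q) ⊛ (𝟙 ⊕ κ (+ q) ⊛ A)) ⊛ (W ⊛ W)) n                    ≡⟨ ⊛-as-sumℤ (κ (+ q) ⊛ (𝟙 ⊕ κ (+ q) ⊛ A)) (W ⊛ W) n ⟩
    sumℤ n (λ ℓ → (κ (+ q) ⊛ (𝟙 ⊕ κ (+ q) ⊛ A)) ℓ * (W ⊛ W) (n ∸ ℓ))
      ≡⟨ sumℤ-cong n (λ ℓ _ → cong (_* (W ⊛ W) (n ∸ ℓ)) (coefficient ℓ)) ⟩
    sumℤ n (rhsTerm n)                                             ∎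
    where
    open ≡-Reasoning
    𝟙≡δ0ℤ : ∀ ℓ → 𝟙 ℓ ≡ δ0ℤ ℓ
    𝟙≡δ0ℤ zero    = refl
    𝟙≡δ0ℤ (suc ℓ) = refl
    coefficient : ∀ ℓ → (κ (+ q) ⊛ (𝟙 ⊕ κ (+ q) ⊛ A)) ℓ ≡ + q * δ0ℤ ℓ + + q * (+ q * A ℓ)
    coefficient ℓ = trans (κ-⊛ (+ q) (𝟙 ⊕ κ (+ q) ⊛ A) ℓ)
      (trans (*-distribˡ-+ (+ q) (𝟙 ℓ) _) (cong₂ (λ u v → + q * u + + q * v) (𝟙≡δ0ℤ ℓ) (κ-⊛ (+ q) A ℓ)))

  -- The factor 1/(r−1) in front of δ is cancelled by one factor q of q² coming from alternating-pair.
  rhs-term : ∀ n ℓ → sgn (n ∸ ℓ) ℚ.* ((δOverRm1 r ℓ ℚ.+ toℚ (Sr r ℓ)) ℚ.* toℚ (T (n ∸ ℓ) ℤ.+ T (n ∸ ℓ ℕ.+ 1))) ≡ toℚ (rhsTerm n ℓ)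
  rhs-term n ℓ = begin
    sgn j ℚ.* ((δ0 ℓ ℚ.* 1/q ℚ.+ toℚ (A ℓ)) ℚ.* pair)
      ≡⟨ solve 5 (λ s d i a t → s :* ((d :* i :+ a) :* t) := (d :* i :+ a) :* (s :* t)) refl (sgn j) (δ0 ℓ) 1/q (toℚ (A ℓ)) pair ⟩
    (δ0 ℓ ℚ.* 1/q ℚ.+ toℚ (A ℓ)) ℚ.* (sgn j ℚ.* pair)
      ≡⟨ cong₂ (λ u v → (u ℚ.* 1/q ℚ.+ toℚ (A ℓ)) ℚ.* v) (δ0≡toℚ-δ0ℤ ℓ) (signed-pair j) ⟩
    (δ ℚ.* 1/q ℚ.+ toℚ (A ℓ)) ℚ.* (Q ℚ.* (Q ℚ.* ww))
      ≡⟨ solve 5 (λ d i a q w → (d :* i :+ a) :* (q :* (q :* w)) := (q :* d :+ q :* (q :* a)) :* w :+ (i :* q :- con ℚ.1ℚ) :* (d :* q :* w))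
               refl δ 1/q (toℚ (A ℓ)) Q ww ⟩
    (Q ℚ.* δ ℚ.+ Q ℚ.* (Q ℚ.* toℚ (A ℓ))) ℚ.* ww ℚ.+ (1/q ℚ.* Q ℚ.- ℚ.1ℚ) ℚ.* (δ ℚ.* Q ℚ.* ww)
      ≡⟨ cong (λ z → (Q ℚ.* δ ℚ.+ Q ℚ.* (Q ℚ.* toℚ (A ℓ))) ℚ.* ww ℚ.+ (z ℚ.- ℚ.1ℚ) ℚ.* (δ ℚ.* Q ℚ.* ww)) (1/[1+k]*[1+k]≡1 k) ⟩
    (Q ℚ.* δ ℚ.+ Q ℚ.* (Q ℚ.* toℚ (A ℓ))) ℚ.* ww ℚ.+ (ℚ.1ℚ ℚ.- ℚ.1ℚ) ℚ.* (δ ℚ.* Q ℚ.* ww)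
      ≡⟨ solve 2 (λ x y → x :+ (con ℚ.1ℚ :- con ℚ.1ℚ) :* y := x) refl ((Q ℚ.* δ ℚ.+ Q ℚ.* (Q ℚ.* toℚ (A ℓ))) ℚ.* ww) (δ ℚ.* Q ℚ.* ww) ⟩
    (Q ℚ.* δ ℚ.+ Q ℚ.* (Q ℚ.* toℚ (A ℓ))) ℚ.* ww
      ≡⟨ cong (ℚ._* ww) (trans (toℚ-+ (+ q * δ0ℤ ℓ) (+ q * (+ q * A ℓ)))
           (cong₂ ℚ._+_ (toℚ-* (+ q) (δ0ℤ ℓ)) (trans (toℚ-* (+ q) (+ q * A ℓ)) (cong (Q ℚ.*_) (toℚ-* (+ q) (A ℓ)))))) ⟨
    toℚ (+ q * δ0ℤ ℓ + + q * (+ q * A ℓ)) ℚ.* ww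
      ≡⟨ toℚ-* (+ q * δ0ℤ ℓ + + q * (+ q * A ℓ)) ((W ⊛ W) j) ⟨
    toℚ (rhsTerm n ℓ) ∎
    where
    open ≡-Reasoning
    open ℚ-Solver
    j : ℕ
    j = n ∸ ℓ
    Q 1/q δ pair ww : ℚ.ℚ
    Q = toℚ (+ q)
    1/q = + 1 ℚ./ q
    δ = toℚ (δ0ℤ ℓ)
    pair = toℚ (T j ℤ.+ T (j ℕ.+ 1))
    ww = toℚ ((W ⊛ W) j)

  rhs≡target : ∀ n → sumℚ n (λ ℓ → sgn (n ∸ ℓ) ℚ.* ((δOverRm1 r ℓ ℚ.+ toℚ (Sr r ℓ))
                     ℚ.* toℚ (S (n ∸ ℓ) -[1+ 0 ] ((+ (r ∸ 1)) ^ 2) ℤ.+ S (n ∸ ℓ ℕ.+ 1) -[1+ 0 ] ((+ (r ∸ 1)) ^ 2))))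
                   ≡ toℚ (target n)
  rhs≡target n = trans (sumℚ-cong n (rhs-term n)) (trans (sumℚ-toℚ n (rhsTerm n)) (cong toℚ (sym (target-as-sum n))))

module LargeSchroder where

  open import Data.Nat as ℕ using (zero; suc)
  import Data.Nat.Properties as ℕ
  open import Data.Integer as ℤ using (-[1+_]; 1ℤ; _+_; -_)
  open import Data.Rational as ℚ using ()
  open import Relation.Binary.PropositionalEquality
  open import Defs using (sumℚ; sgn; toℚ; U; Schr; δ0)
  open PowerSeries
  open IntegerToRational using (δ0ℤ; toℚ-+; δ0≡toℚ-δ0ℤ)
  open ColouredSchroder 0
  open AlternatingSum 0 using (target)
  open BothSides 0 using (lhs≡target)

  -- Both solve Y = 1 + X (Y − Y²).
  W≗𝟙 : W ≗ 𝟙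
  W≗𝟙 = fixed-point-unique (λ Y → Y ⊕ ⊖ (Y ⊛ Y)) 𝟙 causal (≗-trans W-quadratic (rearrange X W)) (𝟙-equation X)
    where
    open SeriesSolver
    rearrange : ∀ x w → 𝟙 ⊕ κ 1ℤ ⊛ x ⊛ w ⊕ κ -[1+ 0 ] ⊛ x ⊛ w ⊛ w ≗ 𝟙 ⊕ x ⊛ (w ⊕ ⊖ (w ⊛ w))
    rearrange = solve 2 (λ x w → con 1ℤ :+ con 1ℤ :* x :* w :+ con -[1+ 0 ] :* x :* w :* w := con 1ℤ :+ x :* (w :- w :* w)) ≗-refl
    𝟙-equation : ∀ x → 𝟙 ≗ 𝟙 ⊕ x ⊛ (𝟙 ⊕ ⊖ (𝟙 ⊛ 𝟙))
    𝟙-equation = solve 1 (λ x → con 1ℤ := con 1ℤ :+ x :* (con 1ℤ :- con 1ℤ :* con 1ℤ)) ≗-refl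
    causal : Causal (λ Y → Y ⊕ ⊖ (Y ⊛ Y))
    causal j Y₁≡Y₂ = cong₂ _+_ (Y₁≡Y₂ j ℕ.≤-refl) (cong -_ (⊛-cong-upTo j Y₁≡Y₂ Y₁≡Y₂))

  target≡δ0+A : ∀ n → target n ≡ δ0ℤ n + A n
  target≡δ0+A n = trans (⊛-cong (⊛-cong (≗-refl {κ 1ℤ ⊛ (𝟙 ⊕ κ 1ℤ ⊛ A)}) W≗𝟙) W≗𝟙 n) (trans (simplify A n) (cong (_+ A n) (𝟙≡δ0ℤ n)))
    where
    open SeriesSolver
    simplify : ∀ a → κ 1ℤ ⊛ (𝟙 ⊕ κ 1ℤ ⊛ a) ⊛ 𝟙 ⊛ 𝟙 ≗ 𝟙 ⊕ a
    simplify = solve 1 (λ a → con 1ℤ :* (con 1ℤ :+ con 1ℤ :* a) :* con 1ℤ :* con 1ℤ := con 1ℤ :+ a) ≗-refl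
    𝟙≡δ0ℤ : ∀ ℓ → 𝟙 ℓ ≡ δ0ℤ ℓ
    𝟙≡δ0ℤ zero    = refl
    𝟙≡δ0ℤ (suc ℓ) = refl

  large-schroder : ∀ n → sumℚ n (λ ℓ → sgn ℓ ℚ.* (toℚ (ℤ.+ U 2 n ℓ) ℚ.* toℚ (Schr (ℓ ℕ.+ 1) ℤ.- Schr ℓ))) ≡ δ0 n ℚ.+ toℚ (Schr n)
  large-schroder n = trans (lhs≡target n) (trans (cong toℚ (target≡δ0+A n))
                                (trans (toℚ-+ (δ0ℤ n) (A n)) (cong (ℚ._+ toℚ (A n)) (sym (δ0≡toℚ-δ0ℤ n)))))

open import Defs
open import Data.Nat using (_≤_; _∸_; _+_; zero; suc; s≤s)
open import Data.Integer using (+_; -[1+_]; _-_; _^_)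
open import Data.Rational using (_*_) renaming (_+_ to _+ℚ_)
open import Data.Product using (_×_; _,_)
open import Relation.Binary.PropositionalEquality using (trans; sym)
open BothSides using (lhs≡target; rhs≡target)
open LargeSchroder using (large-schroder)

corollary4p3 :
    (∀ (r n : ℕ) → 2 ≤ r →
      sumℚ n (λ ℓ → sgn ℓ * (toℚ (+ U r n ℓ) * toℚ (Sr r (ℓ + 1) - Sr r ℓ)))
      ≡ sumℚ n (λ ℓ → sgn (n ∸ ℓ) * ((δOverRm1 r ℓ +ℚ toℚ (Sr r ℓ))
          * toℚ (S (n ∸ ℓ) -[1+ 0 ] ((+ (r ∸ 1)) ^ 2) Data.Integer.+ S (n ∸ ℓ + 1) -[1+ 0 ] ((+ (r ∸ 1)) ^ 2)))))
    × (∀ (n : ℕ) →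
      sumℚ n (λ ℓ → sgn ℓ * (toℚ (+ U 2 n ℓ) * toℚ (Schr (ℓ + 1) - Schr ℓ)))
      ≡ δ0 n +ℚ toℚ (Schr n))
corollary4p3 =
    (λ { (suc (suc k)) n _ → trans (lhs≡target k n) (sym (rhs≡target k n)) ; (suc zero) _ (s≤s ()) ; zero _ () })
  , large-schroder
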